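{- $\delta(112) = \delta(112, 121) = \delta(112,121,211) = 2\sqrt{3} - 3.$
   Context: Patterns are words over a totally ordered alphabet; a word $\sigma$ contains an occurrence of a pattern $\pi$ of length $M$ at a set of $M$ positions if the subsequence of $\sigma$ at those positions is order-isomorphic to $\pi$ (same relative order, with equal letters corresponding to equal letters). Packing density: for a word $\sigma\in[k]^n$ (where $[k]=\{1,\dots,k\}$) and a set $\Pi$ of patterns all of length $M$, let $\nu(\Pi,\sigma)$ be the number of length-$M$ position sets of $\sigma$ at which some pattern of $\Pi$ occurs; let $\delta(\Pi,k,n)=\max\{\nu(\Pi,\sigma)/\binom{n}{M} : \sigma\in[k]^n\}$; the packing density is $\delta(\Pi)=\lim_{n\to\infty}\lim_{k\to\infty}\delta(\Pi,k,n)$. Notation $\delta(\pi_1,\dots,\pi_s)$ means $\delta(\{\pi_1,\dots,\pi_s\})$. -}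

module Defs where

open import Data.Bool using (Bool; true; false; _∧_; _∨_; not)
open import Data.Nat using (ℕ; zero; suc; _⊔_; _<ᵇ_; _≡ᵇ_)
open import Data.Nat.Combinatorics using (_C_)
open import Data.Integer using (+_)
open import Data.Fin using (Fin; toℕ)
open import Data.Vec using (Vec; []; _∷_; lookup)
open import Data.List using (List; []; _∷_; map; _++_; concatMap; allFin; foldr; length; zip; filterᵇ)
open import Data.Bool.ListAction using (all; any)
open import Data.Product using (_×_; _,_; Σ; ∃)
open import Data.Sum using (_⊎_)
open import Data.Rational using (ℚ; 0ℚ; _/_; _+_; _-_; _*_; _<_; _≤_; ∣_∣)
open import Relation.Binary.PropositionalEquality using (_≡_)

-- Words over [k] = {1..k} are modelled as Vec (Fin k) n (letter i ↦ toℕ i + 1;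
-- only the relative order matters, so the shift is irrelevant).

_⇔ᵇ_ : Bool → Bool → Bool
true  ⇔ᵇ b = b
false ⇔ᵇ b = not b

sameOrder : ℕ × ℕ → ℕ × ℕ → Bool
sameOrder (a , b) (c , d) = ((a <ᵇ c) ⇔ᵇ (b <ᵇ d)) ∧ ((a ≡ᵇ c) ⇔ᵇ (b ≡ᵇ d))

orderIso : List ℕ → List ℕ → Bool
orderIso xs ys =
  (length xs ≡ᵇ length ys) ∧
  all (λ p → all (λ q → sameOrder p q) (zip xs ys)) (zip xs ys)

combs : {A : Set} → ℕ → List A → List (List A)
combs zero    xs       = [] ∷ []
combs (suc m) []       = []
combs (suc m) (x ∷ xs) = map (x ∷_) (combs m xs) ++ combs (suc m) xs

allWords : (k n : ℕ) → List (Vec (Fin k) n)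
allWords k zero    = [] ∷ []
allWords k (suc n) = concatMap (λ x → map (x ∷_) (allWords k n)) (allFin k)

subseq : {k n : ℕ} → Vec (Fin k) n → List (Fin n) → List ℕ
subseq σ ps = map (λ p → toℕ (lookup σ p)) ps

ν : (M : ℕ) → List (List ℕ) → {k n : ℕ} → Vec (Fin k) n → ℕ
ν M Π {n = n} σ =
  length (filterᵇ (λ ps → any (λ π → orderIso (subseq σ ps) π) Π) (combs M (allFin n)))

maxℕ : List ℕ → ℕ
maxℕ = foldr _⊔_ 0

-- a / b as a rational (convention: 0 when b = 0, i.e. n < M; irrelevant for the limit)
ratio : ℕ → ℕ → ℚ
ratio a zero    = 0ℚ
ratio a (suc d) = (+ a) / suc d

δ : (M : ℕ) → List (List ℕ) → (k n : ℕ) → ℚ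
δ M Π k n = ratio (maxℕ (map (ν M Π) (allWords k n))) (n C M)

ConvergesTo : (ℕ → ℚ) → ℚ → Set
ConvergesTo f L = ∀ (ε : ℚ) → 0ℚ < ε → ∃ λ K → ∀ k → K Data.Nat.≤ k → ∣ f k - L ∣ < ε

-- The real number α = 2√3 − 3, described by its Dedekind cut:
-- q < α  iff  q + 3 < 2√3  iff  q + 3 < 0  or  (q+3)² < 12
-- α < q  iff  2√3 < q + 3  iff  0 ≤ q + 3  and  12 < (q+3)²
three twelve : ℚ
three  = (+ 3) / 1
twelve = (+ 12) / 1

BelowAlpha : ℚ → Set
BelowAlpha q = (q + three < 0ℚ) ⊎ ((q + three) * (q + three) < twelve)

AboveAlpha : ℚ → Set
AboveAlpha q = (0ℚ ≤ q + three) × (twelve < (q + three) * (q + three))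

ConvergesToAlpha : (ℕ → ℚ) → Set
ConvergesToAlpha L = ∀ (ε : ℚ) → 0ℚ < ε → ∃ λ N → ∀ n → N Data.Nat.≤ n →
  AboveAlpha (L n + ε) × BelowAlpha (L n - ε)

DensityIsAlpha : (M : ℕ) → List (List ℕ) → Set
DensityIsAlpha M Π = Σ (ℕ → ℚ) λ L →
  (∀ n → ConvergesTo (λ k → δ M Π k n) (L n)) × ConvergesToAlpha L

p112 p121 p211 : List ℕ
p112 = 1 ∷ 1 ∷ 2 ∷ []
p121 = 1 ∷ 2 ∷ 1 ∷ []
p211 = 2 ∷ 1 ∷ 1 ∷ []

-- Every occurrence of 112, 121 or 211 is a triple of letters {u, u, w} with u < w ("of type 112"), so
-- ν is at most the number of such triples, with equality for weakly increasing words already when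
-- Π = {112}. Deleting the a copies of the smallest letter from a word of length a + r deletes exactly
-- C(a,2)·r such triples. For naturals B, m and t = B + 3m,
--   4t·(B(a² + 3ar + 3r²) − 3mar) = (2ta − 3(B+m)(a+r))² + 3(t² − 12m²)(a+r)²,
-- so if t² ≥ 12m² then 6m·C(a,2)·r ≤ B((a+r)³ − r³), and by induction 6m·#triples ≤ B·n³.
-- If t² ≤ 12m², taking a = ⌊3(B+m)n / 2t⌋ makes the square smaller than 4t², and the weakly
-- increasing word built from such blocks has B·n³ ≤ 6m·#triples + 2t²·n². Letting B/m tend to
-- 2√3 − 3 from both sides (t/m → √12) squeezes max ν / C(n,3) to 2√3 − 3.

module Submission where

open import Defs
open import Data.Bool using (Bool; true; false; T; _∧_; _∨_)
open import Data.Bool.Properties using (T-∧; T-∨; ∧-zeroʳ; ∧-identityʳ; ∨-identityʳ)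
open import Data.Bool.ListAction using (all; any; and)
open import Data.Empty using (⊥-elim)
open import Data.Fin as Fin using (Fin; toℕ; fromℕ<)
open import Data.Fin.Properties using (toℕ<n; toℕ-fromℕ<)
import Data.Integer.Base as ℤ
import Data.Integer.Properties as ℤ
open import Data.List using (List; []; _∷_; [_]; map; _++_; length; filterᵇ; replicate; zip; allFin)
open import Data.List.Extrema.Nat using (min; min≤⊤; min≤xs; argmin-sel)
open import Data.List.Membership.Propositional using (_∈_)
open import Data.List.Membership.Propositional.Properties using (∈-map⁺; ∈-map⁻; ∈-concatMap⁺; ∈-allFin)
open import Data.List.Properties
  using (map-++; map-∘; map-id; length-map; length-++; length-replicate; map-tabulate; length-tabulate; zip-map)
open import Data.List.Relation.Unary.All as All using (All; []; _∷_)
import Data.List.Relation.Unary.All.Properties as All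
open import Data.List.Relation.Unary.AllPairs as AllPairs using (AllPairs; []; _∷_)
import Data.List.Relation.Unary.AllPairs.Properties as AllPairs
open import Data.List.Relation.Unary.Any as Any using (here; there)
open import Data.List.Relation.Unary.Any.Properties using (any⁺)
open import Data.Nat
open import Data.Nat.Combinatorics using (_C_; nC1≡n; nCk+nC[k+1]≡[n+1]C[k+1])
open import Data.Nat.DivMod using (_/_; _%_; m≡m%n+[m/n]*n; m%n<n)
open import Data.Nat.Induction using (<-rec)
open import Data.Nat.Properties
open import Data.Nat.Tactic.RingSolver using (solve-∀)
open import Algebra.Properties.CommutativeSemigroup +-commutativeSemigroup using (x∙yz≈y∙xz)
open import Data.Product as Product using (_×_; _,_; proj₁; proj₂; Σ-syntax)
open import Data.Rational.Base as ℚ using (mkℚ; 0ℚ; toℚᵘ; nonNegative; positive)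
import Data.Rational.Properties as ℚ
open import Data.Rational.Unnormalised.Base as ℚᵘ using (mkℚᵘ)
import Data.Rational.Unnormalised.Properties as ℚᵘ
open import Data.Sum as Sum using (_⊎_; inj₁; inj₂; [_,_]′)
open import Data.Unit using (tt)
open import Data.Vec using (Vec; []; _∷_; lookup)
import Function
open import Function using (_∘_; _⇔_; Equivalence; mk⇔)
open import Relation.Binary using (tri<; tri≈; tri>)
open import Relation.Binary.PropositionalEquality hiding ([_])
open import Relation.Nullary using (¬_; yes; no)

≡ᵇ-refl : ∀ n → (n ≡ᵇ n) ≡ true
≡ᵇ-refl zero    = refl
≡ᵇ-refl (suc n) = ≡ᵇ-refl n

≢⇒≡ᵇ≡false : ∀ {m n} → m ≢ n → (m ≡ᵇ n) ≡ false
≢⇒≡ᵇ≡false {zero}  {zero}  m≢n = ⊥-elim (m≢n refl)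
≢⇒≡ᵇ≡false {zero}  {suc n} _   = refl
≢⇒≡ᵇ≡false {suc m} {zero}  _   = refl
≢⇒≡ᵇ≡false {suc m} {suc n} m≢n = ≢⇒≡ᵇ≡false (m≢n ∘ cong suc)

<⇒<ᵇ≡true : ∀ {m n} → m < n → (m <ᵇ n) ≡ true
<⇒<ᵇ≡true {zero}  {suc n} _         = refl
<⇒<ᵇ≡true {suc m} {suc n} (s≤s m<n) = <⇒<ᵇ≡true m<n

≤⇒>ᵇ≡false : ∀ {m n} → n ≤ m → (m <ᵇ n) ≡ false
≤⇒>ᵇ≡false {m}     {zero}  _         = refl
≤⇒>ᵇ≡false {suc m} {suc n} (s≤s n≤m) = ≤⇒>ᵇ≡false n≤m

count : {A : Set} → (A → Bool) → List A → ℕ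
count p xs = length (filterᵇ p xs)

module _ {A : Set} where

  count-++ : ∀ (p : A → Bool) xs ys → count p (xs ++ ys) ≡ count p xs + count p ys
  count-++ p []       ys = refl
  count-++ p (x ∷ xs) ys with p x
  ... | true  = cong suc (count-++ p xs ys)
  ... | false = count-++ p xs ys

  count-map : ∀ {B : Set} (p : B → Bool) (f : A → B) xs → count p (map f xs) ≡ count (p ∘ f) xs
  count-map p f []       = refl
  count-map p f (x ∷ xs) with p (f x)
  ... | true  = cong suc (count-map p f xs)
  ... | false = count-map p f xs

  count-cong : ∀ {R : A → Set} (p q : A → Bool) {xs} → All R xs →
               (∀ {x} → R x → p x ≡ q x) → count p xs ≡ count q xs
  count-cong p q {[]}     []       p≗q = refl
  count-cong p q {x ∷ xs} (r ∷ rs) p≗q with p x | q x | p≗q r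
  ... | true  | true  | _ = cong suc (count-cong p q rs p≗q)
  ... | false | false | _ = count-cong p q rs p≗q

  count-mono : ∀ {R : A → Set} (p q : A → Bool) {xs} → All R xs →
               (∀ {x} → R x → T (p x) → T (q x)) → count p xs ≤ count q xs
  count-mono p q {[]}     []       p⇒q = z≤n
  count-mono p q {x ∷ xs} (r ∷ rs) p⇒q with p x | q x | p⇒q r
  ... | true  | true  | _   = s≤s (count-mono p q rs p⇒q)
  ... | true  | false | p⇒q = ⊥-elim (p⇒q _)
  ... | false | true  | _   = m≤n⇒m≤1+n (count-mono p q rs p⇒q)
  ... | false | false | _   = count-mono p q rs p⇒q

  count-mono-< : ∀ (p q : A → Bool) {y xs} → (∀ {x} → T (p x) → T (q x)) →
                 y ∈ xs → T (q y) → ¬ T (p y) → count p xs < count q xs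
  count-mono-< p q {y} {_ ∷ xs} p⇒q (here refl) qy ¬py with p y | q y
  ... | true  | _    = ⊥-elim (¬py _)
  ... | false | true = s≤s (count-mono p q (All.universal (λ _ → tt) xs) (λ _ → p⇒q))
  count-mono-< p q {xs = x ∷ xs} p⇒q (there y∈xs) qy ¬py with p x | q x | p⇒q {x}
  ... | true  | true  | _      = s≤s (count-mono-< p q p⇒q y∈xs qy ¬py)
  ... | true  | false | px⇒qx = ⊥-elim (px⇒qx _)
  ... | false | true  | _      = m<n⇒m<1+n (count-mono-< p q p⇒q y∈xs qy ¬py)
  ... | false | false | _      = count-mono-< p q p⇒q y∈xs qy ¬py

  count-true : ∀ (xs : List A) → count (λ _ → true) xs ≡ length xs
  count-true []       = refl
  count-true (_ ∷ xs) = cong suc (count-true xs)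

  combs-map : ∀ {B : Set} (f : A → B) m xs → combs m (map f xs) ≡ map (map f) (combs m xs)
  combs-map f zero    xs       = refl
  combs-map f (suc m) []       = refl
  combs-map f (suc m) (x ∷ xs) = begin
    map (f x ∷_) (combs m (map f xs)) ++ combs (suc m) (map f xs)
      ≡⟨ cong₂ _++_ (cong (map (f x ∷_)) (combs-map f m xs)) (combs-map f (suc m) xs) ⟩
    map (f x ∷_) (map (map f) (combs m xs)) ++ map (map f) (combs (suc m) xs)
      ≡⟨ cong (_++ map (map f) (combs (suc m) xs)) (trans (sym (map-∘ (combs m xs))) (map-∘ (combs m xs))) ⟩
    map (map f) (map (x ∷_) (combs m xs)) ++ map (map f) (combs (suc m) xs)
      ≡⟨ map-++ (map f) (map (x ∷_) (combs m xs)) (combs (suc m) xs) ⟨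
    map (map f) (map (x ∷_) (combs m xs) ++ combs (suc m) xs) ∎
    where open ≡-Reasoning

  combs-All : ∀ {P : A → Set} m {xs} → All P xs → All (All P) (combs m xs)
  combs-All zero    _          = [] ∷ []
  combs-All (suc m) []         = []
  combs-All (suc m) (px ∷ pxs) =
    All.++⁺ (All.map⁺ (All.map (px ∷_) (combs-All m pxs))) (combs-All (suc m) pxs)

  combs-AllPairs : ∀ {R : A → A → Set} m {xs} → AllPairs R xs → All (AllPairs R) (combs m xs)
  combs-AllPairs zero    _          = [] ∷ []
  combs-AllPairs (suc m) []         = []
  combs-AllPairs (suc m) (Rx ∷ Rxs) =
    All.++⁺ (All.map⁺ (All.zipWith (λ (Rxc , Rc) → Rxc ∷ Rc) (combs-All m Rx , combs-AllPairs m Rxs)))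
            (combs-AllPairs (suc m) Rxs)

-- Triples of type 112

type112₃ : ℕ → ℕ → ℕ → Bool
type112₃ x y z = ((x ≡ᵇ y) ∧ (x <ᵇ z)) ∨ ((x ≡ᵇ z) ∧ (x <ᵇ y)) ∨ ((y ≡ᵇ z) ∧ (y <ᵇ x))

type112 : List ℕ → Bool
type112 (x ∷ y ∷ z ∷ []) = type112₃ x y z
type112 _                = false

T-type112₃ : ∀ {x y z} → T (type112₃ x y z) ⇔ (x ≡ y × x < z ⊎ x ≡ z × x < y ⊎ y ≡ z × y < x)
T-type112₃ {x} {y} {z} = mk⇔
  (Sum.map (atoms x y x z) (Sum.map (atoms x z x y) (atoms y z y x))
    ∘ Sum.map₂ (Equivalence.to T-∨) ∘ Equivalence.to T-∨)
  (Equivalence.from T-∨ ∘ Sum.map₂ (Equivalence.from T-∨)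
    ∘ Sum.map (atoms⁻¹ x y x z) (Sum.map (atoms⁻¹ x z x y) (atoms⁻¹ y z y x)))
  where
  atoms : ∀ a b c d → T ((a ≡ᵇ b) ∧ (c <ᵇ d)) → a ≡ b × c < d
  atoms a b c d = Product.map (≡ᵇ⇒≡ a b) (<ᵇ⇒< c d) ∘ Equivalence.to T-∧
  atoms⁻¹ : ∀ a b c d → a ≡ b × c < d → T ((a ≡ᵇ b) ∧ (c <ᵇ d))
  atoms⁻¹ a b c d = Equivalence.from T-∧ ∘ Product.map (≡⇒≡ᵇ a b) <⇒<ᵇ

type112₃-xxz : ∀ x z → type112₃ x x z ≡ (x <ᵇ z)
type112₃-xxz x z
  rewrite ≡ᵇ-refl x | ≤⇒>ᵇ≡false (≤-refl {x}) | ∧-zeroʳ (x ≡ᵇ z) = ∨-identityʳ (x <ᵇ z)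

type112₃-x<y : ∀ {x y} z → x < y → type112₃ x y z ≡ (x ≡ᵇ z)
type112₃-x<y {x} {y} z x<y
  rewrite ≢⇒≡ᵇ≡false (<⇒≢ x<y) | <⇒<ᵇ≡true x<y | ≤⇒>ᵇ≡false (<⇒≤ x<y)
        | ∧-identityʳ (x ≡ᵇ z) | ∧-zeroʳ (y ≡ᵇ z) = ∨-identityʳ (x ≡ᵇ z)

type112₃-y<x : ∀ {x y} z → y < x → type112₃ x y z ≡ (y ≡ᵇ z)
type112₃-y<x {x} {y} z y<x
  rewrite ≢⇒≡ᵇ≡false (>⇒≢ y<x) | <⇒<ᵇ≡true y<x | ≤⇒>ᵇ≡false (<⇒≤ y<x)
        | ∧-zeroʳ (x ≡ᵇ z) = ∧-identityʳ (y ≡ᵇ z)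

type112₃-below : ∀ {v x y} → v < x → v < y → type112₃ x y v ≡ false
type112₃-below {v} {x} {y} v<x v<y with <-cmp x y
... | tri< x<y _ _  = trans (type112₃-x<y v x<y) (≢⇒≡ᵇ≡false (>⇒≢ v<x))
... | tri≈ _ refl _ = trans (type112₃-xxz x v) (≤⇒>ᵇ≡false (<⇒≤ v<x))
... | tri> _ _ y<x  = trans (type112₃-y<x v y<x) (≢⇒≡ᵇ≡false (>⇒≢ v<y))

count112 : List ℕ → ℕ
count112 w = count type112 (combs 3 w)

pairs112 : ℕ → List ℕ → ℕ
pairs112 x w = count (type112 ∘ (x ∷_)) (combs 2 w)

occ : ℕ → List ℕ → ℕ
occ v = count (v ≡ᵇ_)

above : ℕ → List ℕ → List ℕ
above v = filterᵇ (v <ᵇ_)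

count112-∷ : ∀ x w → count112 (x ∷ w) ≡ pairs112 x w + count112 w
count112-∷ x w = trans (count-++ type112 (map (x ∷_) (combs 2 w)) (combs 3 w))
                       (cong (_+ count112 w) (count-map type112 (x ∷_) (combs 2 w)))

pairs112-∷ : ∀ x y w → pairs112 x (y ∷ w) ≡ count (type112₃ x y) w + pairs112 x w
pairs112-∷ x y w = trans (count-++ (type112 ∘ (x ∷_)) (map (y ∷_) (combs 1 w)) (combs 2 w))
  (cong (_+ pairs112 x w) (begin
    count (type112 ∘ (x ∷_)) (map (y ∷_) (combs 1 w))  ≡⟨ count-map _ (y ∷_) (combs 1 w) ⟩
    count (type112 ∘ (x ∷_) ∘ (y ∷_)) (combs 1 w)      ≡⟨ cong (count _) (combs-1 w) ⟩
    count (type112 ∘ (x ∷_) ∘ (y ∷_)) (map [_] w)      ≡⟨ count-map _ [_] w ⟩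
    count (type112₃ x y) w                             ∎))
  where
  open ≡-Reasoning
  combs-1 : ∀ w → combs 1 w ≡ map [_] w
  combs-1 []      = refl
  combs-1 (z ∷ w) = cong ([ z ] ∷_) (combs-1 w)

suc-C-2 : ∀ a → suc a C 2 ≡ a + a C 2
suc-C-2 a = trans (sym (nCk+nC[k+1]≡[n+1]C[k+1] a 1)) (cong (_+ a C 2) (nC1≡n a))

occ-∷-≡ : ∀ v w → occ v (v ∷ w) ≡ suc (occ v w)
occ-∷-≡ v w rewrite ≡ᵇ-refl v = refl

occ-∷-< : ∀ {v y} w → v < y → occ v (y ∷ w) ≡ occ v w
occ-∷-< w v<y rewrite ≢⇒≡ᵇ≡false (<⇒≢ v<y) = refl

above-∷-≡ : ∀ v w → above v (v ∷ w) ≡ above v w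
above-∷-≡ v w rewrite ≤⇒>ᵇ≡false (≤-refl {v}) = refl

above-∷-< : ∀ {v y} w → v < y → above v (y ∷ w) ≡ y ∷ above v w
above-∷-< w v<y rewrite <⇒<ᵇ≡true v<y = refl

count-above : ∀ {v} (p : ℕ → Bool) w → All (v ≤_) w → p v ≡ false → count p (above v w) ≡ count p w
count-above     p []      []          _        = refl
count-above {v} p (y ∷ w) (v≤y ∷ v≤w) pv≡false with m≤n⇒m<n∨m≡n v≤y
... | inj₂ refl rewrite above-∷-≡ v w | pv≡false = count-above p w v≤w pv≡false
... | inj₁ v<y  rewrite above-∷-< w v<y with p y
...   | true  = cong suc (count-above p w v≤w pv≡false)
...   | false = count-above p w v≤w pv≡false

length-above : ∀ {v} w → All (v ≤_) w → length w ≡ occ v w + length (above v w)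
length-above     []      []          = refl
length-above {v} (y ∷ w) (v≤y ∷ v≤w) with m≤n⇒m<n∨m≡n v≤y
... | inj₂ refl = trans (cong suc (length-above w v≤w))
                        (sym (cong₂ (λ a r → a + length r) (occ-∷-≡ v w) (above-∷-≡ v w)))
... | inj₁ v<y  = trans (cong suc (length-above w v≤w))
                        (trans (sym (+-suc (occ v w) _))
                               (sym (cong₂ (λ a r → a + length r) (occ-∷-< w v<y) (above-∷-< w v<y))))

pairs112-min : ∀ {v} w → All (v ≤_) w → pairs112 v w ≡ occ v w * length (above v w)
pairs112-min     []      []          = refl
pairs112-min {v} (y ∷ w) (v≤y ∷ v≤w) with m≤n⇒m<n∨m≡n v≤y
... | inj₂ refl = begin
  pairs112 v (v ∷ w)                        ≡⟨ pairs112-∷ v v w ⟩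
  count (type112₃ v v) w + pairs112 v w     ≡⟨ cong₂ _+_ (count-cong _ _ v≤w (λ {z} _ → type112₃-xxz v z))
                                                         (pairs112-min w v≤w) ⟩
  suc (occ v w) * length (above v w)        ≡⟨ cong₂ (λ a r → a * length r) (occ-∷-≡ v w) (above-∷-≡ v w) ⟨
  occ v (v ∷ w) * length (above v (v ∷ w))  ∎
  where open ≡-Reasoning
... | inj₁ v<y = begin
  pairs112 v (y ∷ w)                        ≡⟨ pairs112-∷ v y w ⟩
  count (type112₃ v y) w + pairs112 v w     ≡⟨ cong₂ _+_ (count-cong _ _ v≤w (λ {z} _ → type112₃-x<y z v<y))
                                                         (pairs112-min w v≤w) ⟩
  occ v w + occ v w * length (above v w)    ≡⟨ *-suc (occ v w) _ ⟨
  occ v w * length (y ∷ above v w)          ≡⟨ cong₂ (λ a r → a * length r) (occ-∷-< w v<y) (above-∷-< w v<y) ⟨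
  occ v (y ∷ w) * length (above v (y ∷ w))  ∎
  where open ≡-Reasoning

pairs112-above : ∀ {v x} w → v < x → All (v ≤_) w → pairs112 x w ≡ occ v w C 2 + pairs112 x (above v w)
pairs112-above         []      _   []          = refl
pairs112-above {v} {x} (y ∷ w) v<x (v≤y ∷ v≤w) with m≤n⇒m<n∨m≡n v≤y
... | inj₂ refl = begin
  pairs112 x (v ∷ w)                                ≡⟨ pairs112-∷ x v w ⟩
  count (type112₃ x v) w + pairs112 x w             ≡⟨ cong₂ _+_ (count-cong _ _ v≤w (λ {z} _ → type112₃-y<x z v<x))
                                                                 (pairs112-above w v<x v≤w) ⟩
  occ v w + (occ v w C 2 + pairs112 x (above v w))  ≡⟨ +-assoc (occ v w) _ _ ⟨
  occ v w + occ v w C 2 + pairs112 x (above v w)    ≡⟨ cong (_+ pairs112 x (above v w)) (suc-C-2 (occ v w)) ⟨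
  suc (occ v w) C 2 + pairs112 x (above v w)        ≡⟨ cong₂ (λ a r → a C 2 + pairs112 x r) (occ-∷-≡ v w) (above-∷-≡ v w) ⟨
  occ v (v ∷ w) C 2 + pairs112 x (above v (v ∷ w))  ∎
  where open ≡-Reasoning
... | inj₁ v<y = begin
  pairs112 x (y ∷ w)
    ≡⟨ pairs112-∷ x y w ⟩
  count (type112₃ x y) w + pairs112 x w
    ≡⟨ cong₂ _+_ (sym (count-above _ w v≤w (type112₃-below v<x v<y))) (pairs112-above w v<x v≤w) ⟩
  count (type112₃ x y) (above v w) + (occ v w C 2 + pairs112 x (above v w))
    ≡⟨ x∙yz≈y∙xz (count (type112₃ x y) (above v w)) (occ v w C 2) (pairs112 x (above v w)) ⟩
  occ v w C 2 + (count (type112₃ x y) (above v w) + pairs112 x (above v w))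
    ≡⟨ cong (occ v w C 2 +_) (pairs112-∷ x y (above v w)) ⟨
  occ v w C 2 + pairs112 x (y ∷ above v w)
    ≡⟨ cong₂ (λ a r → a C 2 + pairs112 x r) (occ-∷-< w v<y) (above-∷-< w v<y) ⟨
  occ v (y ∷ w) C 2 + pairs112 x (above v (y ∷ w))
    ∎
  where open ≡-Reasoning

count112-min : ∀ {v} w → All (v ≤_) w → count112 w ≡ (occ v w C 2) * length (above v w) + count112 (above v w)
count112-min     []      []          = refl
count112-min {v} (y ∷ w) (v≤y ∷ v≤w) with m≤n⇒m<n∨m≡n v≤y
... | inj₂ refl = begin
  count112 (v ∷ w)                                          ≡⟨ count112-∷ v w ⟩
  pairs112 v w + count112 w                                 ≡⟨ cong₂ _+_ (pairs112-min w v≤w) (count112-min w v≤w) ⟩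
  occ v w * R + ((occ v w C 2) * R + count112 (above v w))  ≡⟨ distrib (occ v w) (occ v w C 2) R _ ⟩
  (occ v w + occ v w C 2) * R + count112 (above v w)        ≡⟨ cong (λ c → c * R + count112 (above v w)) (suc-C-2 (occ v w)) ⟨
  (suc (occ v w) C 2) * R + count112 (above v w)            ≡⟨ cong₂ (λ a r → (a C 2) * length r + count112 r)
                                                                     (occ-∷-≡ v w) (above-∷-≡ v w) ⟨
  (occ v (v ∷ w) C 2) * length (above v (v ∷ w)) + count112 (above v (v ∷ w)) ∎
  where
  open ≡-Reasoning
  R = length (above v w)
  distrib : ∀ a c r t → a * r + (c * r + t) ≡ (a + c) * r + t
  distrib = solve-∀
... | inj₁ v<y = begin
  count112 (y ∷ w)                                             ≡⟨ count112-∷ y w ⟩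
  pairs112 y w + count112 w                                    ≡⟨ cong₂ _+_ (pairs112-above w v<y v≤w) (count112-min w v≤w) ⟩
  occ v w C 2 + P + ((occ v w C 2) * R + count112 (above v w)) ≡⟨ regroup (occ v w C 2) P R _ ⟩
  (occ v w C 2) * suc R + (P + count112 (above v w))           ≡⟨ cong ((occ v w C 2) * suc R +_) (count112-∷ y (above v w)) ⟨
  (occ v w C 2) * length (y ∷ above v w) + count112 (y ∷ above v w)
    ≡⟨ cong₂ (λ a r → (a C 2) * length r + count112 r) (occ-∷-< w v<y) (above-∷-< w v<y) ⟨
  (occ v (y ∷ w) C 2) * length (above v (y ∷ w)) + count112 (above v (y ∷ w)) ∎
  where
  open ≡-Reasoning
  P = pairs112 y (above v w)
  R = length (above v w)
  regroup : ∀ c p r t → c + p + (c * r + t) ≡ c * suc r + (p + t)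
  regroup = solve-∀

family112 : List (List ℕ)
family112 = p112 ∷ p121 ∷ p211 ∷ []

matches : List (List ℕ) → List ℕ → Bool
matches Π c = any (orderIso c) Π

⇔ᵇ⇒≡ : ∀ {p q} → T (p ⇔ᵇ q) → p ≡ q
⇔ᵇ⇒≡ {true}  {true}  _ = refl
⇔ᵇ⇒≡ {false} {false} _ = refl

module _ (x a y b : ℕ) (h : T (sameOrder (x , a) (y , b))) where

  sameOrder-< : a < b → x < y
  sameOrder-< a<b = <ᵇ⇒< x y (subst T (sym (⇔ᵇ⇒≡ (proj₁ (Equivalence.to T-∧ h)))) (<⇒<ᵇ a<b))

  sameOrder-≡ : a ≡ b → x ≡ y
  sameOrder-≡ a≡b = ≡ᵇ⇒≡ x y (subst T (sym (⇔ᵇ⇒≡ (proj₂ (Equivalence.to T-∧ h)))) (≡⇒≡ᵇ a b a≡b))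

orderIso₃⇒sameOrder : ∀ x y z a b c → T (orderIso (x ∷ y ∷ z ∷ []) (a ∷ b ∷ c ∷ [])) →
  T (sameOrder (x , a) (y , b)) × T (sameOrder (x , a) (z , c)) ×
  T (sameOrder (y , b) (x , a)) × T (sameOrder (y , b) (z , c))
orderIso₃⇒sameOrder x y z a b c h
  using xyz ← (x , a) ∷ (y , b) ∷ (z , c) ∷ []
  with rowx ∷ rowy ∷ _ ∷ [] ← All.all⁺ (λ p → all (sameOrder p) xyz) xyz h
  with _ ∷ sxy ∷ sxz ∷ []   ← All.all⁺ (sameOrder (x , a)) xyz rowx
  with syx ∷ _ ∷ syz ∷ []   ← All.all⁺ (sameOrder (y , b)) xyz rowy
  = sxy , sxz , syx , syz

type112-of-orderIso : ∀ c {π} → π ∈ family112 → T (orderIso c π) → T (type112 c)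
type112-of-orderIso (x ∷ y ∷ z ∷ []) (here refl) h
  with sxy , sxz , _ ← orderIso₃⇒sameOrder x y z 1 1 2 h =
  Equivalence.from T-type112₃ (inj₁ (sameOrder-≡ x 1 y 1 sxy refl , sameOrder-< x 1 z 2 sxz ≤-refl))
type112-of-orderIso (x ∷ y ∷ z ∷ []) (there (here refl)) h
  with sxy , sxz , _ ← orderIso₃⇒sameOrder x y z 1 2 1 h =
  Equivalence.from T-type112₃ (inj₂ (inj₁ (sameOrder-≡ x 1 z 1 sxz refl , sameOrder-< x 1 y 2 sxy ≤-refl)))
type112-of-orderIso (x ∷ y ∷ z ∷ []) (there (there (here refl))) h
  with _ , _ , syx , syz ← orderIso₃⇒sameOrder x y z 2 1 1 h =
  Equivalence.from T-type112₃ (inj₂ (inj₂ (sameOrder-≡ y 1 z 1 syz refl , sameOrder-< y 1 x 2 syx ≤-refl)))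

orderIso-xxz-112 : ∀ {x z} → x < z → T (orderIso (x ∷ x ∷ z ∷ []) p112)
orderIso-xxz-112 {x} {z} x<z
  rewrite ≡ᵇ-refl x | ≡ᵇ-refl z | ≤⇒>ᵇ≡false (≤-refl {x}) | ≤⇒>ᵇ≡false (≤-refl {z})
        | <⇒<ᵇ≡true x<z | ≤⇒>ᵇ≡false (<⇒≤ x<z) | ≢⇒≡ᵇ≡false (<⇒≢ x<z) | ≢⇒≡ᵇ≡false (>⇒≢ x<z) = _

orderIso-112-of-sorted : ∀ {c} → AllPairs _≤_ c → T (type112 c) → T (orderIso c p112)
orderIso-112-of-sorted {x ∷ y ∷ z ∷ []} ((x≤y ∷ _) ∷ (y≤z ∷ []) ∷ _) h
  with Equivalence.to (T-type112₃ {x} {y} {z}) h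
... | inj₁ (refl , x<z)        = orderIso-xxz-112 x<z
... | inj₂ (inj₁ (refl , x<y)) = ⊥-elim (<⇒≱ x<y y≤z)
... | inj₂ (inj₂ (refl , y<x)) = ⊥-elim (<⇒≱ y<x x≤y)

type112-of-matches : ∀ {Π} c → All (_∈ family112) Π → T (matches Π c) → T (type112 c)
type112-of-matches c (π∈ ∷ Π⊆) h with Equivalence.to T-∨ h
... | inj₁ c≈π = type112-of-orderIso c π∈ c≈π
... | inj₂ c≈Π = type112-of-matches c Π⊆ c≈Π

matches-of-sorted : ∀ {Π c} → p112 ∈ Π → AllPairs _≤_ c → T (type112 c) → T (matches Π c)
matches-of-sorted {c = c} 112∈Π sorted h =
  any⁺ (orderIso c) (Any.map (λ e → subst (T ∘ orderIso c) e (orderIso-112-of-sorted sorted h)) 112∈Π)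

letters : ∀ {k n} → Vec (Fin k) n → List ℕ
letters {n = n} σ = subseq σ (allFin n)

ν-letters : ∀ Π {k n} (σ : Vec (Fin k) n) → ν 3 Π σ ≡ count (matches Π) (combs 3 (letters σ))
ν-letters Π {n = n} σ = sym (begin
  count (matches Π) (combs 3 (map letter (allFin n)))        ≡⟨ cong (count (matches Π)) (combs-map letter 3 (allFin n)) ⟩
  count (matches Π) (map (map letter) (combs 3 (allFin n)))  ≡⟨ count-map (matches Π) (map letter) (combs 3 (allFin n)) ⟩
  ν 3 Π σ                                                    ∎)
  where
  open ≡-Reasoning
  letter = λ i → toℕ (lookup σ i)

ν-cong : ∀ Π {k k′ n} (σ : Vec (Fin k) n) (τ : Vec (Fin k′) n) → letters σ ≡ letters τ → ν 3 Π σ ≡ ν 3 Π τ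
ν-cong Π σ τ eq = trans (ν-letters Π σ) (trans (cong (count (matches Π) ∘ combs 3) eq) (sym (ν-letters Π τ)))

letters-∷ : ∀ {k n} x (σ : Vec (Fin k) n) → letters (x ∷ σ) ≡ toℕ x ∷ letters σ
letters-∷ x σ = cong (toℕ x ∷_) (trans (map-tabulate Fin.suc _) (sym (map-tabulate Function.id _)))

length-letters : ∀ {k n} (σ : Vec (Fin k) n) → length (letters σ) ≡ n
length-letters {n = n} σ = trans (length-map _ (allFin n)) (length-tabulate Function.id)

letters-< : ∀ {k n} (σ : Vec (Fin k) n) → All (_< k) (letters σ)
letters-< σ = All.map⁺ (All.tabulate (λ {i} _ → toℕ<n (lookup σ i)))

fromLetters : ∀ {k} n w → length w ≡ n → All (_< k) w → Σ[ σ ∈ Vec (Fin k) n ] letters σ ≡ w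
fromLetters zero    []      _       []          = [] , refl
fromLetters (suc n) (x ∷ w) |w|≡1+n (x<k ∷ w<k) with σ , σ≡w ← fromLetters n w (suc-injective |w|≡1+n) w<k =
  fromℕ< x<k ∷ σ , trans (letters-∷ (fromℕ< x<k) σ) (cong₂ _∷_ (toℕ-fromℕ< x<k) σ≡w)

∈-allWords : ∀ {k n} (σ : Vec (Fin k) n) → σ ∈ allWords k n
∈-allWords             []      = here refl
∈-allWords {k} {suc n} (x ∷ σ) = ∈-concatMap⁺ (λ y → map (y ∷_) (allWords k n))
  (Any.map (λ x≡y → subst (λ y → x ∷ σ ∈ map (y ∷_) (allWords k n)) x≡y (∈-map⁺ (x ∷_) (∈-allWords σ)))
           (∈-allFin x))

≤-maxℕ : ∀ {x xs} → x ∈ xs → x ≤ maxℕ xs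
≤-maxℕ {xs = y ∷ ys} (here refl)  = m≤m⊔n y (maxℕ ys)
≤-maxℕ {xs = y ∷ ys} (there x∈ys) = ≤-trans (≤-maxℕ x∈ys) (m≤n⊔m y (maxℕ ys))

maxℕ-sel : ∀ xs → maxℕ xs ≡ 0 ⊎ maxℕ xs ∈ xs
maxℕ-sel []       = inj₁ refl
maxℕ-sel (x ∷ xs) with ⊔-sel x (maxℕ xs)
... | inj₁ x⊔m≡x = inj₂ (here x⊔m≡x)
... | inj₂ x⊔m≡m = Sum.map (trans x⊔m≡m) (there ∘ subst (_∈ xs) (sym x⊔m≡m)) (maxℕ-sel xs)

maxν : List (List ℕ) → ℕ → ℕ → ℕ
maxν Π k n = maxℕ (map (ν 3 Π) (allWords k n))

ν≤maxν : ∀ Π {k n} (σ : Vec (Fin k) n) → ν 3 Π σ ≤ maxν Π k n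
ν≤maxν Π σ = ≤-maxℕ (∈-map⁺ (ν 3 Π) (∈-allWords σ))

maxν-attained : ∀ Π k n → maxν Π k n ≡ 0 ⊎ Σ[ σ ∈ Vec (Fin k) n ] maxν Π k n ≡ ν 3 Π σ
maxν-attained Π k n = Sum.map₂ (λ m∈ → let σ , _ , m≡νσ = ∈-map⁻ (ν 3 Π) m∈ in σ , m≡νσ)
                               (maxℕ-sel (map (ν 3 Π) (allWords k n)))

module _ (w : List ℕ) where

  rank : ℕ → ℕ
  rank a = count (_<ᵇ a) w

  rank-mono : ∀ {a b} → a ∈ w → a < b → rank a < rank b
  rank-mono {a} {b} a∈w a<b = count-mono-< (_<ᵇ a) (_<ᵇ b)
    (λ {x} x<a → <⇒<ᵇ (<-trans (<ᵇ⇒< x a x<a) a<b)) a∈w (<⇒<ᵇ a<b) (<-irrefl refl ∘ <ᵇ⇒< a a)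

  rank-< : ∀ {a} → a ∈ w → rank a < length w
  rank-< {a} a∈w = subst (rank a <_) (count-true w)
    (count-mono-< (_<ᵇ a) (λ _ → true) _ a∈w _ (<-irrefl refl ∘ <ᵇ⇒< a a))

module _ {S : ℕ → Set} (f : ℕ → ℕ) (f-mono : ∀ {a b} → S a → S b → a < b → f a < f b) where

  private
    <ᵇ-preserved : ∀ {a b} → S a → S b → (f a <ᵇ f b) ≡ (a <ᵇ b)
    <ᵇ-preserved {a} {b} sa sb with <-cmp a b
    ... | tri< a<b _ _  = trans (<⇒<ᵇ≡true (f-mono sa sb a<b)) (sym (<⇒<ᵇ≡true a<b))
    ... | tri≈ _ refl _ = trans (≤⇒>ᵇ≡false (≤-refl {f a})) (sym (≤⇒>ᵇ≡false (≤-refl {a})))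
    ... | tri> _ _ b<a  = trans (≤⇒>ᵇ≡false (<⇒≤ (f-mono sb sa b<a))) (sym (≤⇒>ᵇ≡false (<⇒≤ b<a)))

    ≡ᵇ-preserved : ∀ {a b} → S a → S b → (f a ≡ᵇ f b) ≡ (a ≡ᵇ b)
    ≡ᵇ-preserved {a} {b} sa sb with <-cmp a b
    ... | tri< a<b _ _  = trans (≢⇒≡ᵇ≡false (<⇒≢ (f-mono sa sb a<b))) (sym (≢⇒≡ᵇ≡false (<⇒≢ a<b)))
    ... | tri≈ _ refl _ = trans (≡ᵇ-refl (f a)) (sym (≡ᵇ-refl a))
    ... | tri> _ _ b<a  = trans (≢⇒≡ᵇ≡false (>⇒≢ (f-mono sb sa b<a))) (sym (≢⇒≡ᵇ≡false (>⇒≢ b<a)))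

    sameOrder-preserved : ∀ {a b} → S a → S b → ∀ p q → sameOrder (f a , p) (f b , q) ≡ sameOrder (a , p) (b , q)
    sameOrder-preserved sa sb p q rewrite <ᵇ-preserved sa sb | ≡ᵇ-preserved sa sb = refl

    all-map : ∀ {B C : Set} (P : C → Bool) (g : B → C) xs → all P (map g xs) ≡ all (P ∘ g) xs
    all-map P g xs = cong and (sym (map-∘ xs))

    all-cong : ∀ {B : Set} {R : B → Set} (P Q : B → Bool) {xs} → All R xs →
               (∀ {x} → R x → P x ≡ Q x) → all P xs ≡ all Q xs
    all-cong P Q []       P≗Q = refl
    all-cong P Q (r ∷ rs) P≗Q = cong₂ _∧_ (P≗Q r) (all-cong P Q rs P≗Q)

    zip-All : ∀ {c} → All S c → (π : List ℕ) → All (S ∘ proj₁) (zip c π)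
    zip-All []       _       = []
    zip-All (_ ∷ _)  []      = []
    zip-All (s ∷ ss) (_ ∷ π) = s ∷ zip-All ss π

  orderIso-map : ∀ {c} → All S c → ∀ π → orderIso (map f c) π ≡ orderIso c π
  orderIso-map {c} Sc π = cong₂ _∧_ (cong (_≡ᵇ length π) (length-map f c)) (begin
    all (λ p → all (sameOrder p) (zip (map f c) π)) (zip (map f c) π)
      ≡⟨ cong (λ Z → all (λ p → all (sameOrder p) Z) Z) fcπ≡ ⟩
    all (λ p → all (sameOrder p) (map f₁ cπ)) (map f₁ cπ)
      ≡⟨ all-map _ f₁ cπ ⟩
    all (λ p → all (sameOrder (f₁ p)) (map f₁ cπ)) cπ
      ≡⟨ all-cong _ _ (zip-All Sc π) (λ {(a , p)} sa → trans (all-map _ f₁ cπ)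
           (all-cong _ _ (zip-All Sc π) (λ {(b , q)} sb → sameOrder-preserved sa sb p q))) ⟩
    all (λ p → all (sameOrder p) cπ) cπ ∎)
    where
    open ≡-Reasoning
    f₁ : ℕ × ℕ → ℕ × ℕ
    f₁ = Product.map₁ f
    cπ = zip c π
    fcπ≡ : zip (map f c) π ≡ map f₁ cπ
    fcπ≡ = trans (cong (zip (map f c)) (sym (map-id π))) (zip-map f Function.id c π)

  matches-map : ∀ Π {c} → All S c → matches Π (map f c) ≡ matches Π c
  matches-map []      _  = refl
  matches-map (π ∷ Π) Sc = cong₂ _∨_ (orderIso-map Sc π) (matches-map Π Sc)

-- Replacing every letter by its rank keeps all pattern occurrences and needs only n letters.
compress : ∀ Π {k n} (σ : Vec (Fin k) n) → Σ[ τ ∈ Vec (Fin n) n ] ν 3 Π τ ≡ ν 3 Π σ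
compress Π {n = n} σ = τ , (begin
  ν 3 Π τ                                             ≡⟨ ν-letters Π τ ⟩
  count (matches Π) (combs 3 (letters τ))             ≡⟨ cong (count (matches Π) ∘ combs 3) τ≡rw ⟩
  count (matches Π) (combs 3 (map (rank w) w))        ≡⟨ cong (count (matches Π)) (combs-map (rank w) 3 w) ⟩
  count (matches Π) (map (map (rank w)) (combs 3 w))  ≡⟨ count-map (matches Π) (map (rank w)) (combs 3 w) ⟩
  count (matches Π ∘ map (rank w)) (combs 3 w)        ≡⟨ count-cong _ _ (combs-All 3 (All.tabulate Function.id))
                                                                     (matches-map (rank w) (λ a∈w _ → rank-mono w a∈w) Π) ⟩
  count (matches Π) (combs 3 w)                       ≡⟨ ν-letters Π σ ⟨
  ν 3 Π σ                                             ∎)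
  where
  open ≡-Reasoning
  w = letters σ
  |rw|≡n : length (map (rank w) w) ≡ n
  |rw|≡n = trans (length-map _ w) (length-letters σ)
  rw<n : All (_< n) (map (rank w) w)
  rw<n = All.map⁺ (All.tabulate (λ {a} a∈w → subst (rank w a <_) (length-letters σ) (rank-< w a∈w)))
  compressed = fromLetters n (map (rank w) w) |rw|≡n rw<n
  τ = proj₁ compressed
  τ≡rw = proj₂ compressed

maxν-stable : ∀ Π {k n} → n ≤ k → maxν Π k n ≡ maxν Π n n
maxν-stable Π {k} {n} n≤k = ≤-antisym
  ([ (λ m≡0 → subst (_≤ maxν Π n n) (sym m≡0) z≤n)
   , (λ (σ , m≡νσ) → let τ , ντ≡νσ = compress Π σ in
       subst (_≤ maxν Π n n) (trans ντ≡νσ (sym m≡νσ)) (ν≤maxν Π τ)) ]′ (maxν-attained Π k n))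
  ([ (λ m≡0 → subst (_≤ maxν Π k n) (sym m≡0) z≤n)
   , (λ (τ , m≡ντ) → let σ , σ≡τ = fromLetters n (letters τ) (length-letters τ)
                                                 (All.map (λ i<n → ≤-trans i<n n≤k) (letters-< τ)) in
       subst (_≤ maxν Π k n) (trans (ν-cong Π σ τ σ≡τ) (sym m≡ντ)) (ν≤maxν Π σ)) ]′ (maxν-attained Π n n))

ν≤count112 : ∀ {Π} → All (_∈ family112) Π → ∀ {k n} (σ : Vec (Fin k) n) → ν 3 Π σ ≤ count112 (letters σ)
ν≤count112 {Π} Π⊆ σ = subst (_≤ count112 (letters σ)) (sym (ν-letters Π σ))
  (count-mono (matches Π) type112 (All.universal (λ _ → tt) (combs 3 (letters σ)))
              (λ {c} _ → type112-of-matches c Π⊆))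

count112≤ν : ∀ {Π} → p112 ∈ Π → ∀ {k n} (σ : Vec (Fin k) n) → AllPairs _≤_ (letters σ) →
             count112 (letters σ) ≤ ν 3 Π σ
count112≤ν {Π} 112∈Π σ sorted = subst (count112 (letters σ) ≤_) (sym (ν-letters Π σ))
  (count-mono type112 (matches Π) (combs-AllPairs 3 sorted) (matches-of-sorted 112∈Π))

2*nC2+n≡n*n : ∀ n → 2 * (n C 2) + n ≡ n * n
2*nC2+n≡n*n zero    = refl
2*nC2+n≡n*n (suc n) = begin
  2 * (suc n C 2) + suc n     ≡⟨ cong (λ c → 2 * c + suc n) (suc-C-2 n) ⟩
  2 * (n + n C 2) + suc n     ≡⟨ regroup n (n C 2) ⟩
  suc (2 * n + (2 * (n C 2) + n)) ≡⟨ cong (λ s → suc (2 * n + s)) (2*nC2+n≡n*n n) ⟩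
  suc (2 * n + n * n)         ≡⟨ square n ⟩
  suc n * suc n               ∎
  where
  open ≡-Reasoning
  regroup : ∀ n c → 2 * (n + c) + suc n ≡ suc (2 * n + (2 * c + n))
  regroup = solve-∀
  square : ∀ n → suc (2 * n + n * n) ≡ suc n * suc n
  square = solve-∀

2*m*n≤m*m+n*n : ∀ m n → 2 * m * n ≤ m * m + n * n
2*m*n≤m*m+n*n m n =
  [ ordered , (λ n≤m → subst₂ _≤_ (swap n m) (+-comm (n * n) (m * m)) (ordered n≤m)) ]′ (≤-total m n)
  where
  swap : ∀ n m → 2 * n * m ≡ 2 * m * n
  swap = solve-∀
  expand : ∀ m d → 2 * m * (m + d) + d * d ≡ m * m + (m + d) * (m + d)
  expand = solve-∀
  ordered : ∀ {m n} → m ≤ n → 2 * m * n ≤ m * m + n * n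
  ordered {m} m≤n with d , refl ← m≤n⇒∃[o]m+o≡n m≤n = ≤-trans (m≤m+n _ (d * d)) (≤-reflexive (expand m d))

quadForm : ℕ → ℕ → ℕ → ℕ
quadForm B a r = B * (a * a + 3 * a * r + 3 * r * r)

-- With t = B + 3m, x = 2ta and y = 3(B+m)(a+r) this is
-- 4t·(quadForm B a r − 3mar) = (x − y)² + 3(t² − 12m²)(a+r)², rearranged to avoid subtraction.
quadForm-identity : ∀ B m a r →
    4 * (B + 3 * m) * (B * (a * a + 3 * a * r + 3 * r * r))
      + (2 * (2 * (B + 3 * m) * a) * (3 * (B + m) * (a + r)) + 3 * (12 * (m * m)) * ((a + r) * (a + r)))
  ≡ 4 * (B + 3 * m) * (3 * m * a * r)
      + (((2 * (B + 3 * m) * a) * (2 * (B + 3 * m) * a) + (3 * (B + m) * (a + r)) * (3 * (B + m) * (a + r)))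
         + 3 * ((B + 3 * m) * (B + 3 * m)) * ((a + r) * (a + r)))
quadForm-identity = solve-∀

quadForm-≥ : ∀ B m a r → 12 * (m * m) ≤ (B + 3 * m) * (B + 3 * m) → 3 * m * a * r ≤ quadForm B a r
quadForm-≥ B zero      a r _    = z≤n
quadForm-≥ B m@(suc _) a r disc =
  *-cancelˡ-≤ (4 * t) {{>-nonZero 0<4t}} (+-cancelʳ-≤ (2 * x * y + 3 * (12 * (m * m)) * (s * s)) _ _ (begin
    4 * t * (3 * m * a * r) + (2 * x * y + 3 * (12 * (m * m)) * (s * s))
      ≤⟨ +-monoʳ-≤ (4 * t * (3 * m * a * r))
           (+-mono-≤ (2*m*n≤m*m+n*n x y) (*-monoˡ-≤ (s * s) (*-monoʳ-≤ 3 disc))) ⟩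
    4 * t * (3 * m * a * r) + ((x * x + y * y) + 3 * (t * t) * (s * s))
      ≡⟨ quadForm-identity B m a r ⟨
    4 * t * quadForm B a r + (2 * x * y + 3 * (12 * (m * m)) * (s * s)) ∎))
  where
  open ≤-Reasoning
  t = B + 3 * m
  x = 2 * t * a
  y = 3 * (B + m) * (a + r)
  s = a + r
  0<4t : 0 < 4 * t
  0<4t = *-monoʳ-< 4 (<-≤-trans z<s (m≤n+m (3 * m) B))

quadForm-< : ∀ B m a r e → (B + 3 * m) * (B + 3 * m) ≤ 12 * (m * m) →
             2 * (B + 3 * m) * a + e ≡ 3 * (B + m) * (a + r) → e < 2 * (B + 3 * m) →
             quadForm B a r < 3 * m * a * r + (B + 3 * m)
quadForm-< B m a r e disc x+e≡y e<2t = *-cancelˡ-< (4 * t) _ _ (begin-strict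
  4 * t * quadForm B a r
    ≤⟨ +-cancelʳ-≤ K _ _ (begin
         4 * t * quadForm B a r + K
           ≡⟨ quadForm-identity B m a r ⟩
         4 * t * (3 * m * a * r) + ((x * x + y * y) + 3 * (t * t) * (s * s))
           ≡⟨ cong (λ q → 4 * t * (3 * m * a * r) + (q + 3 * (t * t) * (s * s))) x²+y²≡2xy+e² ⟩
         4 * t * (3 * m * a * r) + ((2 * x * y + e * e) + 3 * (t * t) * (s * s))
           ≤⟨ +-monoʳ-≤ (4 * t * (3 * m * a * r)) (+-monoʳ-≤ (2 * x * y + e * e) (*-monoˡ-≤ (s * s) (*-monoʳ-≤ 3 disc))) ⟩
         4 * t * (3 * m * a * r) + ((2 * x * y + e * e) + 3 * (12 * (m * m)) * (s * s))
           ≡⟨ regroup (4 * t * (3 * m * a * r)) (2 * x * y) (e * e) (3 * (12 * (m * m)) * (s * s)) ⟩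
         4 * t * (3 * m * a * r) + e * e + K ∎) ⟩
  4 * t * (3 * m * a * r) + e * e
    <⟨ +-monoʳ-< (4 * t * (3 * m * a * r)) (subst (e * e <_) (2t*2t≡4t*t t) (*-mono-< e<2t e<2t)) ⟩
  4 * t * (3 * m * a * r) + 4 * t * t
    ≡⟨ *-distribˡ-+ (4 * t) (3 * m * a * r) t ⟨
  4 * t * (3 * m * a * r + t) ∎)
  where
  open ≤-Reasoning
  t = B + 3 * m
  x = 2 * t * a
  y = 3 * (B + m) * (a + r)
  s = a + r
  K = 2 * x * y + 3 * (12 * (m * m)) * (s * s)
  x²+y²≡2xy+e² : x * x + y * y ≡ 2 * x * y + e * e
  x²+y²≡2xy+e² = subst (λ y → x * x + y * y ≡ 2 * x * y + e * e) x+e≡y (square-sum x e)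
    where square-sum : ∀ x e → x * x + (x + e) * (x + e) ≡ 2 * x * (x + e) + e * e
          square-sum = solve-∀
  2t*2t≡4t*t : ∀ t → 2 * t * (2 * t) ≡ 4 * t * t
  2t*2t≡4t*t = solve-∀
  regroup : ∀ c d f k → c + ((d + f) + k) ≡ c + f + (d + k)
  regroup = solve-∀


cube-split : ∀ B a r → B * ((a + r) * (a + r) * (a + r)) ≡ a * (B * (a * a + 3 * a * r + 3 * r * r)) + B * (r * r * r)
cube-split = solve-∀

-- Upper bound

upper-bound-step : ∀ B m a r F → 12 * (m * m) ≤ (B + 3 * m) * (B + 3 * m) →
  6 * m * F ≤ B * (r * r * r) → 6 * m * ((a C 2) * r + F) ≤ B * ((a + r) * (a + r) * (a + r))
upper-bound-step B m a r F disc ih = begin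
  6 * m * ((a C 2) * r + F)              ≡⟨ regroup m (a C 2) r F ⟩
  3 * m * r * (2 * (a C 2)) + 6 * m * F  ≤⟨ +-mono-≤ (*-monoʳ-≤ (3 * m * r) 2*aC2≤a*a) ih ⟩
  3 * m * r * (a * a) + B * (r * r * r)  ≡⟨ cong (_+ B * (r * r * r)) (factor m r a) ⟩
  a * (3 * m * a * r) + B * (r * r * r)  ≤⟨ +-monoˡ-≤ (B * (r * r * r)) (*-monoʳ-≤ a (quadForm-≥ B m a r disc)) ⟩
  a * quadForm B a r + B * (r * r * r)   ≡⟨ cube-split B a r ⟨
  B * ((a + r) * (a + r) * (a + r))      ∎
  where
  open ≤-Reasoning
  2*aC2≤a*a : 2 * (a C 2) ≤ a * a
  2*aC2≤a*a = subst (2 * (a C 2) ≤_) (2*nC2+n≡n*n a) (m≤m+n _ a)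
  regroup : ∀ m c r F → 6 * m * (c * r + F) ≡ 3 * m * r * (2 * c) + 6 * m * F
  regroup = solve-∀
  factor : ∀ m r a → 3 * m * r * (a * a) ≡ a * (3 * m * a * r)
  factor = solve-∀

occ-pos : ∀ {v w} → v ∈ w → 0 < occ v w
occ-pos {v} {_ ∷ w} (here refl) = subst (0 <_) (sym (occ-∷-≡ v w)) z<s
occ-pos {v} {x ∷ w} (there v∈w) with v ≡ᵇ x
... | true  = z<s
... | false = occ-pos v∈w

count112-upper : ∀ B m → 12 * (m * m) ≤ (B + 3 * m) * (B + 3 * m) →
                 ∀ w → 6 * m * count112 w ≤ B * (length w * length w * length w)
count112-upper B m disc u = <-rec P bound (length u) u refl
  where
  P : ℕ → Set
  P n = ∀ w → length w ≡ n → 6 * m * count112 w ≤ B * (n * n * n)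
  bound : ∀ n → (∀ {k} → k < n → P k) → P n
  bound n rec []         refl = ≤-reflexive (trans (*-zeroʳ (6 * m)) (sym (*-zeroʳ B)))
  bound n rec w@(x ∷ xs) refl = subst₂ (λ c l → 6 * m * c ≤ B * (l * l * l))
    (sym (count112-min w v≤w)) (sym |w|≡a+R)
    (upper-bound-step B m a R (count112 (above v w)) disc (rec R<n (above v w) refl))
    where
    v = min x xs
    v≤w : All (v ≤_) w
    v≤w = min≤⊤ x xs ∷ min≤xs x xs
    a = occ v w
    R = length (above v w)
    |w|≡a+R : length w ≡ a + R
    |w|≡a+R = length-above w v≤w
    R<n : R < length w
    R<n = subst (R <_) (sym |w|≡a+R)
            (+-monoˡ-≤ R (occ-pos ([ here , there ]′ (argmin-sel Function.id x xs))))

-- Lower bound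

lower-bound-increment : ∀ B m D a r e → 1 ≤ a → B + 3 * m ≤ D → 3 * m ≤ 2 * D →
  (B + 3 * m) * (B + 3 * m) ≤ 12 * (m * m) →
  2 * (B + 3 * m) * a + e ≡ 3 * (B + m) * (a + r) → e < 2 * (B + 3 * m) →
  B * ((a + r) * (a + r) * (a + r)) + D * (r * r) ≤ 6 * m * ((a C 2) * r) + B * (r * r * r) + D * ((a + r) * (a + r))
lower-bound-increment B m D a r e 1≤a t≤D 3m≤2D disc x+e≡y e<2t = begin
  B * ((a + r) * (a + r) * (a + r)) + D * (r * r)
    ≡⟨ trans (cong (_+ D * (r * r)) (cube-split B a r)) (+-assoc (a * quadForm B a r) _ _) ⟩
  a * quadForm B a r + X
    ≤⟨ +-monoˡ-≤ X (*-monoʳ-≤ a (<⇒≤ (quadForm-< B m a r e disc x+e≡y e<2t))) ⟩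
  a * (3 * m * a * r + t) + X
    ≡⟨ distribute m a r t X ⟩
  3 * m * r * (a * a) + a * t + X
    ≡⟨ cong (λ q → 3 * m * r * q + a * t + X) (2*nC2+n≡n*n a) ⟨
  3 * m * r * (2 * (a C 2) + a) + a * t + X
    ≡⟨ split-square m r (a C 2) a (a * t) X ⟩
  6 * m * ((a C 2) * r) + (3 * m * (a * r) + a * t) + X
    ≤⟨ +-monoˡ-≤ X (+-monoʳ-≤ (6 * m * ((a C 2) * r))
         (+-mono-≤ (*-monoˡ-≤ (a * r) 3m≤2D) (*-mono-≤ (m≤m*n a a {{>-nonZero 1≤a}}) t≤D))) ⟩
  6 * m * ((a C 2) * r) + (2 * D * (a * r) + a * a * D) + X
    ≡⟨ collect m r (a C 2) a D (B * (r * r * r)) ⟩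
  6 * m * ((a C 2) * r) + B * (r * r * r) + D * ((a + r) * (a + r)) ∎
  where
  open ≤-Reasoning
  t = B + 3 * m
  X = B * (r * r * r) + D * (r * r)
  distribute : ∀ m a r t X → a * (3 * m * a * r + t) + X ≡ 3 * m * r * (a * a) + a * t + X
  distribute = solve-∀
  split-square : ∀ m r c a u X → 3 * m * r * (2 * c + a) + u + X ≡ 6 * m * (c * r) + (3 * m * (a * r) + u) + X
  split-square = solve-∀
  collect : ∀ m r c a D Y → 6 * m * (c * r) + (2 * D * (a * r) + a * a * D) + (Y + D * (r * r))
                          ≡ 6 * m * (c * r) + Y + D * ((a + r) * (a + r))
  collect = solve-∀

lower-bound-step : ∀ B m D a r e F → 1 ≤ a → B + 3 * m ≤ D → 3 * m ≤ 2 * D →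
  (B + 3 * m) * (B + 3 * m) ≤ 12 * (m * m) →
  2 * (B + 3 * m) * a + e ≡ 3 * (B + m) * (a + r) → e < 2 * (B + 3 * m) →
  B * (r * r * r) ≤ 6 * m * F + D * (r * r) →
  B * ((a + r) * (a + r) * (a + r)) ≤ 6 * m * ((a C 2) * r + F) + D * ((a + r) * (a + r))
lower-bound-step B m D a r e F 1≤a t≤D 3m≤2D disc x+e≡y e<2t ih = +-cancelʳ-≤ (D * (r * r)) _ _ (begin
  B * ((a + r) * (a + r) * (a + r)) + D * (r * r)
    ≤⟨ lower-bound-increment B m D a r e 1≤a t≤D 3m≤2D disc x+e≡y e<2t ⟩
  6 * m * ((a C 2) * r) + B * (r * r * r) + D * ((a + r) * (a + r))
    ≤⟨ +-monoˡ-≤ (D * ((a + r) * (a + r))) (+-monoʳ-≤ (6 * m * ((a C 2) * r)) ih) ⟩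
  6 * m * ((a C 2) * r) + (6 * m * F + D * (r * r)) + D * ((a + r) * (a + r))
    ≡⟨ regroup m (a C 2) r F D (D * ((a + r) * (a + r))) ⟩
  6 * m * ((a C 2) * r + F) + D * ((a + r) * (a + r)) + D * (r * r) ∎)
  where
  open ≤-Reasoning
  regroup : ∀ m c r F D N → 6 * m * (c * r) + (6 * m * F + D * (r * r)) + N ≡ 6 * m * (c * r + F) + N + D * (r * r)
  regroup = solve-∀

block : ℕ → List ℕ → List ℕ
block a w = replicate a 0 ++ map suc w

occ-block : ∀ a w → occ 0 (block a w) ≡ a
occ-block (suc a) w       = cong suc (occ-block a w)
occ-block zero    []      = refl
occ-block zero    (_ ∷ w) = occ-block zero w

above-block : ∀ a w → above 0 (block a w) ≡ map suc w
above-block (suc a) w       = above-block a w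
above-block zero    []      = refl
above-block zero    (x ∷ w) = cong (suc x ∷_) (above-block zero w)

length-block : ∀ a w → length (block a w) ≡ a + length w
length-block a w = trans (length-++ (replicate a 0)) (cong₂ _+_ (length-replicate a) (length-map suc w))

count112-map-suc : ∀ w → count112 (map suc w) ≡ count112 w
count112-map-suc w = begin
  count type112 (combs 3 (map suc w))        ≡⟨ cong (count type112) (combs-map suc 3 w) ⟩
  count type112 (map (map suc) (combs 3 w))  ≡⟨ count-map type112 (map suc) (combs 3 w) ⟩
  count (type112 ∘ map suc) (combs 3 w)      ≡⟨ count-cong _ _ (All.universal (λ _ → tt) (combs 3 w)) (λ {c} _ → shift c) ⟩
  count type112 (combs 3 w)                  ∎
  where
  open ≡-Reasoning
  shift : ∀ c → type112 (map suc c) ≡ type112 c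
  shift []                    = refl
  shift (_ ∷ [])              = refl
  shift (_ ∷ _ ∷ [])          = refl
  shift (_ ∷ _ ∷ _ ∷ [])      = refl
  shift (_ ∷ _ ∷ _ ∷ _ ∷ _)   = refl

count112-block : ∀ a w → count112 (block a w) ≡ (a C 2) * length w + count112 w
count112-block a w = begin
  count112 (block a w)
    ≡⟨ count112-min (block a w) (All.universal (λ _ → z≤n) (block a w)) ⟩
  (occ 0 (block a w) C 2) * length (above 0 (block a w)) + count112 (above 0 (block a w))
    ≡⟨ cong₂ (λ o u → (o C 2) * length u + count112 u) (occ-block a w) (above-block a w) ⟩
  (a C 2) * length (map suc w) + count112 (map suc w)
    ≡⟨ cong₂ (λ l c → (a C 2) * l + c) (length-map suc w) (count112-map-suc w) ⟩
  (a C 2) * length w + count112 w ∎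
  where open ≡-Reasoning

block-sorted : ∀ a {w} → AllPairs _≤_ w → AllPairs _≤_ (block a w)
block-sorted a {w} sorted = AllPairs.++⁺ (zeros-sorted a) (AllPairs.map⁺ (AllPairs.map s≤s sorted))
                                         (All.replicate⁺ a (All.universal (λ _ → z≤n) (map suc w)))
  where
  zeros-sorted : ∀ a → AllPairs _≤_ (replicate a 0)
  zeros-sorted zero    = []
  zeros-sorted (suc a) = All.universal (λ _ → z≤n) (replicate a 0) ∷ zeros-sorted a

DenseWord : ℕ → ℕ → ℕ → Set
DenseWord B m n = Σ[ w ∈ List ℕ ] length w ≡ n × AllPairs _≤_ w ×
  B * (n * n * n) ≤ 6 * m * count112 w + 2 * ((B + 3 * m) * (B + 3 * m)) * (n * n)

module _ (B m : ℕ) .{{_ : NonZero m}} (disc : (B + 3 * m) * (B + 3 * m) ≤ 12 * (m * m)) where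

  private
    open ≤-Reasoning

    t = B + 3 * m
    D = 2 * (t * t)
    p = 3 * (B + m)
    q = 2 * t

    0<t : 0 < t
    0<t = <-≤-trans (*-monoʳ-< 3 (>-nonZero⁻¹ m)) (m≤n+m (3 * m) B)

    instance
      p≢0 : NonZero p
      p≢0 = >-nonZero (*-monoʳ-< 3 (<-≤-trans (>-nonZero⁻¹ m) (m≤n+m m B)))
      q≢0 : NonZero q
      q≢0 = >-nonZero (*-monoʳ-< 2 0<t)

    B≤3m : B ≤ 3 * m
    B≤3m = ≮⇒≥ λ 3m<B → <-irrefl refl (begin-strict
      12 * (m * m)                        ≤⟨ m≤m+n (12 * (m * m)) (24 * (m * m)) ⟩
      12 * (m * m) + 24 * (m * m)         ≡⟨ 36m² m ⟩
      (3 * m + 3 * m) * (3 * m + 3 * m)   <⟨ *-mono-< (+-monoˡ-< (3 * m) 3m<B) (+-monoˡ-< (3 * m) 3m<B) ⟩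
      t * t                               ≤⟨ disc ⟩
      12 * (m * m)                        ∎)
      where 36m² : ∀ m → 12 * (m * m) + 24 * (m * m) ≡ (3 * m + 3 * m) * (3 * m + 3 * m)
            36m² = solve-∀

    p≤q : p ≤ q
    p≤q = subst₂ _≤_ (sym (expand-p B m)) (sym (expand-q B m)) (+-monoʳ-≤ (2 * B + 3 * m) B≤3m)
      where expand-p : ∀ B m → 3 * (B + m) ≡ 2 * B + 3 * m + B
            expand-p = solve-∀
            expand-q : ∀ B m → 2 * (B + 3 * m) ≡ 2 * B + 3 * m + 3 * m
            expand-q = solve-∀

    t≤D : t ≤ D
    t≤D = ≤-trans (m≤m*n t t {{>-nonZero 0<t}}) (m≤n*m (t * t) 2)

    3m≤2D : 3 * m ≤ 2 * D
    3m≤2D = ≤-trans (m≤n+m (3 * m) B) (≤-trans t≤D (m≤n*m D 2))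

    single-block : ∀ n → p * n < q → DenseWord B m n
    single-block n pn<q = block n [] , trans (length-block n []) (+-identityʳ n) , block-sorted n [] , (begin
      B * (n * n * n)                              ≡⟨ reassoc B n ⟩
      B * n * (n * n)                              ≤⟨ *-monoˡ-≤ (n * n) Bn≤D ⟩
      D * (n * n)                                  ≤⟨ m≤n+m (D * (n * n)) _ ⟩
      6 * m * count112 (block n []) + D * (n * n)  ∎)
      where
      reassoc : ∀ B n → B * (n * n * n) ≡ B * n * (n * n)
      reassoc = solve-∀
      twice : ∀ t → t * (2 * t) ≡ 2 * (t * t)
      twice = solve-∀
      Bn≤D : B * n ≤ D
      Bn≤D = begin
        B * n    ≤⟨ *-monoʳ-≤ B (<⇒≤ (≤-<-trans (m≤n*m n p) pn<q)) ⟩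
        B * q    ≤⟨ *-monoˡ-≤ q (m≤m+n B (3 * m)) ⟩
        t * q    ≡⟨ twice t ⟩
        D        ∎

    prepend-block : ∀ a r e → 1 ≤ a → p * (a + r) ≡ e + a * q → e < q → DenseWord B m r → DenseWord B m (a + r)
    prepend-block a _ e 1≤a p[a+r]≡e+aq e<q (w , refl , sorted , dense) =
      block a w , length-block a w , block-sorted a sorted ,
      subst (λ c → B * (n * n * n) ≤ 6 * m * c + D * (n * n)) (sym (count112-block a w))
        (lower-bound-step B m D a (length w) e (count112 w) 1≤a t≤D 3m≤2D disc x+e≡y e<q dense)
      where
      n = a + length w
      swap : ∀ t a e → 2 * t * a + e ≡ e + a * (2 * t)
      swap = solve-∀
      x+e≡y : 2 * t * a + e ≡ 3 * (B + m) * n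
      x+e≡y = trans (swap t a e) (sym p[a+r]≡e+aq)

    build : ∀ n → (∀ {k} → k < n → DenseWord B m k) → DenseWord B m n
    build n rec with p * n / q | m≡m%n+[m/n]*n (p * n) q
    ... | zero   | pn≡e    = single-block n (subst (_< q) (sym (trans pn≡e (+-identityʳ _))) (m%n<n (p * n) q))
    ... | suc a′ | pn≡e+aq = subst (DenseWord B m) a+r≡n
      (prepend-block a r e z<s (trans (cong (p *_) a+r≡n) pn≡e+aq) (m%n<n (p * n) q) (rec r<n))
      where
      a = suc a′
      e = p * n % q
      a≤n : a ≤ n
      a≤n = *-cancelʳ-≤ a n q (begin
        a * q      ≤⟨ m≤n+m (a * q) e ⟩
        e + a * q  ≡⟨ pn≡e+aq ⟨
        p * n      ≤⟨ *-monoˡ-≤ n p≤q ⟩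
        q * n      ≡⟨ *-comm q n ⟩
        n * q      ∎)
      r = n ∸ a
      a+r≡n : a + r ≡ n
      a+r≡n = m+[n∸m]≡n a≤n
      r<n : r < n
      r<n = subst (r <_) a+r≡n (m<n+m r z<s)

  -- The first block has a = ⌊3(B+m)n / 2t⌋ letters, so that 3(B+m)n − 2ta < 2t.
  dense-words : ∀ n → DenseWord B m n
  dense-words = <-rec (DenseWord B m) build

maxν-upper : ∀ {Π} → All (_∈ family112) Π → ∀ B m → 12 * (m * m) ≤ (B + 3 * m) * (B + 3 * m) →
             ∀ k n → 6 * m * maxν Π k n ≤ B * (n * n * n)
maxν-upper {Π} Π⊆ B m disc k n with maxν-attained Π k n
... | inj₁ max≡0 rewrite max≡0 | *-zeroʳ (6 * m) = z≤n
... | inj₂ (σ , max≡νσ) rewrite max≡νσ = begin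
  6 * m * ν 3 Π σ                 ≤⟨ *-monoʳ-≤ (6 * m) (ν≤count112 Π⊆ σ) ⟩
  6 * m * count112 (letters σ)    ≤⟨ count112-upper B m disc (letters σ) ⟩
  B * (l * l * l)                 ≡⟨ cong (λ l → B * (l * l * l)) (length-letters σ) ⟩
  B * (n * n * n)                 ∎
  where open ≤-Reasoning
        l = length (letters σ)

maxν-lower : ∀ {Π} → p112 ∈ Π → ∀ B m .{{_ : NonZero m}} → (B + 3 * m) * (B + 3 * m) ≤ 12 * (m * m) →
             ∀ n → B * (n * n * n) ≤ 6 * m * maxν Π n n + 2 * ((B + 3 * m) * (B + 3 * m)) * (n * n)
maxν-lower {Π} 112∈Π B m disc n with w , |w|≡n , sorted , dense ← dense-words B m disc n =
  ≤-trans dense (+-monoˡ-≤ _ (*-monoʳ-≤ (6 * m) (begin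
    count112 w                ≡⟨ cong count112 σ≡w ⟨
    count112 (letters σ)      ≤⟨ count112≤ν 112∈Π σ (subst (AllPairs _≤_) (sym σ≡w) sorted) ⟩
    ν 3 Π σ                   ≡⟨ proj₂ (compress Π σ) ⟨
    ν 3 Π (proj₁ (compress Π σ)) ≤⟨ ν≤maxν Π (proj₁ (compress Π σ)) ⟩
    maxν Π n n                ∎)))
  where
  open ≤-Reasoning
  realised = fromLetters n w |w|≡n (All.tabulate (λ x∈w → s≤s (≤-maxℕ x∈w)))
  σ = proj₁ realised
  σ≡w = proj₂ realised

toℚᵘ-ratio : ∀ a b → toℚᵘ (ratio a (suc b)) ℚᵘ.≃ mkℚᵘ (ℤ.+ a) b
toℚᵘ-ratio a b = ℚ.toℚᵘ-fromℚᵘ (mkℚᵘ (ℤ.+ a) b)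

ratio-+ : ∀ a b c d → ratio a (suc b) ℚ.+ ratio c (suc d) ≡ ratio (a * suc d + c * suc b) (suc b * suc d)
ratio-+ a b c d = ℚ.toℚᵘ-injective (ℚᵘ.≃-trans (ℚ.toℚᵘ-homo-+ (ratio a (suc b)) (ratio c (suc d)))
  (ℚᵘ.≃-trans (ℚᵘ.+-cong (toℚᵘ-ratio a b) (toℚᵘ-ratio c d))
    (ℚᵘ.≃-trans (ℚᵘ.≃-reflexive (cong (λ n → mkℚᵘ n _) numerator)) (ℚᵘ.≃-sym (toℚᵘ-ratio _ _)))))
  where
  numerator : ℤ.+ a ℤ.* ℤ.+ suc d ℤ.+ ℤ.+ c ℤ.* ℤ.+ suc b ≡ ℤ.+ (a * suc d + c * suc b)
  numerator = trans (cong₂ ℤ._+_ (sym (ℤ.pos-* a (suc d))) (sym (ℤ.pos-* c (suc b))))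
                    (sym (ℤ.pos-+ (a * suc d) (c * suc b)))

ratio-* : ∀ a b c d → ratio a (suc b) ℚ.* ratio c (suc d) ≡ ratio (a * c) (suc b * suc d)
ratio-* a b c d = ℚ.toℚᵘ-injective (ℚᵘ.≃-trans (ℚ.toℚᵘ-homo-* (ratio a (suc b)) (ratio c (suc d)))
  (ℚᵘ.≃-trans (ℚᵘ.*-cong (toℚᵘ-ratio a b) (toℚᵘ-ratio c d))
    (ℚᵘ.≃-trans (ℚᵘ.≃-reflexive (cong (λ n → mkℚᵘ n _) (sym (ℤ.pos-* a c)))) (ℚᵘ.≃-sym (toℚᵘ-ratio _ _)))))

ratio-≤ : ∀ a b c d → a * suc d ≤ c * suc b → ratio a (suc b) ℚ.≤ ratio c (suc d)
ratio-≤ a b c d h = ℚ.toℚᵘ-cancel-≤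
  (ℚᵘ.≤-respˡ-≃ (ℚᵘ.≃-sym (toℚᵘ-ratio a b)) (ℚᵘ.≤-respʳ-≃ (ℚᵘ.≃-sym (toℚᵘ-ratio c d))
    (ℚᵘ.*≤* (subst₂ ℤ._≤_ (ℤ.pos-* a (suc d)) (ℤ.pos-* c (suc b)) (ℤ.+≤+ h)))))

ratio-< : ∀ a b c d → a * suc d < c * suc b → ratio a (suc b) ℚ.< ratio c (suc d)
ratio-< a b c d h = ℚ.toℚᵘ-cancel-<
  (ℚᵘ.<-respˡ-≃ (ℚᵘ.≃-sym (toℚᵘ-ratio a b)) (ℚᵘ.<-respʳ-≃ (ℚᵘ.≃-sym (toℚᵘ-ratio c d))
    (ℚᵘ.*<* (subst₂ ℤ._<_ (ℤ.pos-* a (suc d)) (ℤ.pos-* c (suc b)) (ℤ.+<+ h)))))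

aboveAlpha-of : ∀ {y} r → 0ℚ ℚ.≤ r → twelve ℚ.< r ℚ.* r → r ℚ.≤ y ℚ.+ three → AboveAlpha y
aboveAlpha-of {y} r 0≤r 12<r² r≤y+3 = 0≤y+3 , ℚ.<-≤-trans 12<r² (ℚ.≤-trans
  (ℚ.*-monoˡ-≤-nonNeg r {{nonNegative 0≤r}} r≤y+3) (ℚ.*-monoʳ-≤-nonNeg (y ℚ.+ three) {{nonNegative 0≤y+3}} r≤y+3))
  where 0≤y+3 = ℚ.≤-trans 0≤r r≤y+3

belowAlpha-of : ∀ {y} r → r ℚ.* r ℚ.≤ twelve → y ℚ.+ three ℚ.< r → BelowAlpha y
belowAlpha-of {y} r r²≤12 y+3<r with 0ℚ ℚ.≤? (y ℚ.+ three)
... | no  0≰y+3 = inj₁ (ℚ.≰⇒> 0≰y+3)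
... | yes 0≤y+3 = inj₂ (ℚ.<-≤-trans (ℚ.≤-<-trans
  (ℚ.*-monoˡ-≤-nonNeg (y ℚ.+ three) {{nonNegative 0≤y+3}} (ℚ.<⇒≤ y+3<r))
  (ℚ.*-monoˡ-<-pos r {{positive (ℚ.≤-<-trans 0≤y+3 y+3<r)}} y+3<r)) r²≤12)

aboveAlpha-of-ratio : ∀ {y} s M → 12 * (suc M * suc M) < s * s → ratio s (suc M) ℚ.≤ y ℚ.+ three → AboveAlpha y
aboveAlpha-of-ratio {y} s M 12M²<s² = aboveAlpha-of {y} (ratio s (suc M)) (ratio-≤ 0 0 s M z≤n)
  (subst (twelve ℚ.<_) (sym (ratio-* s M s M))
    (ratio-< 12 0 (s * s) _ (subst (12 * (suc M * suc M) <_) (sym (*-identityʳ (s * s))) 12M²<s²)))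

belowAlpha-of-ratio : ∀ {y} s M → s * s ≤ 12 * (suc M * suc M) → y ℚ.+ three ℚ.< ratio s (suc M) → BelowAlpha y
belowAlpha-of-ratio {y} s M s²≤12M² = belowAlpha-of {y} (ratio s (suc M))
  (subst (ℚ._≤ twelve) (sym (ratio-* s M s M))
    (ratio-≤ (s * s) _ 12 0 (subst (_≤ 12 * (suc M * suc M)) (sym (*-identityʳ (s * s))) s²≤12M²)))

p+3<q+e⇒p-e+3<q : ∀ p e q → p ℚ.+ three ℚ.< q ℚ.+ e → p ℚ.- e ℚ.+ three ℚ.< q
p+3<q+e⇒p-e+3<q p e q p+3<q+e = subst₂ ℚ._<_ reorder cancel (ℚ.+-monoˡ-< (ℚ.- e) p+3<q+e)
  where
  open ≡-Reasoning
  reorder : p ℚ.+ three ℚ.- e ≡ p ℚ.- e ℚ.+ three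
  reorder = begin
    p ℚ.+ three ℚ.- e        ≡⟨ ℚ.+-assoc p three (ℚ.- e) ⟩
    p ℚ.+ (three ℚ.- e)      ≡⟨ cong (p ℚ.+_) (ℚ.+-comm three (ℚ.- e)) ⟩
    p ℚ.+ (ℚ.- e ℚ.+ three)  ≡⟨ ℚ.+-assoc p (ℚ.- e) three ⟨
    p ℚ.- e ℚ.+ three        ∎
  cancel : q ℚ.+ e ℚ.- e ≡ q
  cancel = trans (ℚ.+-assoc q e (ℚ.- e)) (trans (cong (q ℚ.+_) (ℚ.+-inverseʳ e)) (ℚ.+-identityʳ q))

-- V/C stands for δ, K/Q for ε and t/M for an approximation of √12.
module _ (V c′ k q′ m′ t : ℕ) (2Q<KM : 2 * suc q′ < suc k * suc m′) where

  private
    Cn = suc c′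
    Q = suc q′
    K = suc k
    M = suc m′

  aboveAlpha-of-ratio-bound : t * Cn ≤ M * V + Cn + 3 * M * Cn → 12 * (M * M) < suc t * suc t →
                              AboveAlpha (ratio V Cn ℚ.+ ratio K Q)
  aboveAlpha-of-ratio-bound tC≤ 12M²<[1+t]² = aboveAlpha-of-ratio {ratio V Cn ℚ.+ ratio K Q} (suc t) m′ 12M²<[1+t]²
    (subst (ratio (suc t) M ℚ.≤_) (sym sum≡) (ratio-≤ (suc t) m′ ((V * Q + K * Cn) * 1 + 3 * (Cn * Q)) ((q′ + c′ * Q) * 1) (begin
      suc t * (Cn * Q * 1)                        ≡⟨ expand t Cn Q ⟩
      t * Cn * Q + Cn * Q                         ≤⟨ +-monoˡ-≤ (Cn * Q) (*-monoˡ-≤ Q tC≤) ⟩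
      (M * V + Cn + 3 * M * Cn) * Q + Cn * Q      ≡⟨ regroup M V Cn Q ⟩
      (M * V + 3 * M * Cn) * Q + 2 * Q * Cn       ≤⟨ +-monoʳ-≤ ((M * V + 3 * M * Cn) * Q) (*-monoˡ-≤ Cn (<⇒≤ 2Q<KM)) ⟩
      (M * V + 3 * M * Cn) * Q + K * M * Cn       ≡⟨ collect M V Cn Q K ⟩
      ((V * Q + K * Cn) * 1 + 3 * (Cn * Q)) * M   ∎)))
    where
    open ≤-Reasoning
    sum≡ : ratio V Cn ℚ.+ ratio K Q ℚ.+ three ≡ ratio ((V * Q + K * Cn) * 1 + 3 * (Cn * Q)) (Cn * Q * 1)
    sum≡ = trans (cong (ℚ._+ three) (ratio-+ V c′ K q′)) (ratio-+ (V * Q + K * Cn) _ 3 0)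
    expand : ∀ t Cn Q → suc t * (Cn * Q * 1) ≡ t * Cn * Q + Cn * Q
    expand = solve-∀
    regroup : ∀ M V Cn Q → (M * V + Cn + 3 * M * Cn) * Q + Cn * Q ≡ (M * V + 3 * M * Cn) * Q + 2 * Q * Cn
    regroup = solve-∀
    collect : ∀ M V Cn Q K → (M * V + 3 * M * Cn) * Q + K * M * Cn ≡ ((V * Q + K * Cn) * 1 + 3 * (Cn * Q)) * M
    collect = solve-∀

  belowAlpha-of-ratio-bound : M * V + 3 * M * Cn ≤ (t + 2) * Cn → t * t ≤ 12 * (M * M) →
                              BelowAlpha (ratio V Cn ℚ.- ratio K Q)
  belowAlpha-of-ratio-bound MV+3MC≤ t²≤12M² = belowAlpha-of-ratio {ratio V Cn ℚ.- ratio K Q} t m′ t²≤12M²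
    (p+3<q+e⇒p-e+3<q (ratio V Cn) (ratio K Q) (ratio t M)
      (subst₂ ℚ._<_ (sym (ratio-+ V c′ 3 0)) (sym (ratio-+ t m′ K q′)) (ratio-< (V * 1 + 3 * Cn) (c′ * 1) (t * Q + K * M) (q′ + m′ * Q) (begin-strict
        (V * 1 + 3 * Cn) * (M * Q)  ≡⟨ expand V Cn M Q ⟩
        (M * V + 3 * M * Cn) * Q    ≤⟨ *-monoˡ-≤ Q MV+3MC≤ ⟩
        (t + 2) * Cn * Q            ≡⟨ regroup t Cn Q ⟩
        t * Q * Cn + 2 * Q * Cn     <⟨ +-monoʳ-< (t * Q * Cn) (*-monoˡ-< Cn 2Q<KM) ⟩
        t * Q * Cn + K * M * Cn     ≡⟨ collect t Q K M Cn ⟩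
        (t * Q + K * M) * (Cn * 1)  ∎))))
    where
    open ≤-Reasoning
    expand : ∀ V Cn M Q → (V * 1 + 3 * Cn) * (M * Q) ≡ (M * V + 3 * M * Cn) * Q
    expand = solve-∀
    regroup : ∀ t Cn Q → (t + 2) * Cn * Q ≡ t * Q * Cn + 2 * Q * Cn
    regroup = solve-∀
    collect : ∀ t Q K M Cn → t * Q * Cn + K * M * Cn ≡ (t * Q + K * M) * (Cn * 1)
    collect = solve-∀

-- The limit

isqrt : ∀ X → Σ[ t ∈ ℕ ] t * t ≤ X × X < suc t * suc t
isqrt zero = 0 , z≤n , z<s
isqrt (suc X) with isqrt X
... | t , t²≤X , X<[1+t]² with suc t * suc t ≤? suc X
...   | yes [1+t]²≤1+X = suc t , [1+t]²≤1+X , ≤-<-trans X<[1+t]² (*-mono-< (n<1+n (suc t)) (n<1+n (suc t)))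
...   | no  [1+t]²≰1+X = t , ≤-trans t²≤X (n≤1+n X) , ≰⇒> [1+t]²≰1+X

C-2-falling : ∀ j → 2 * ((2 + j) C 2) ≡ (2 + j) * (1 + j)
C-2-falling zero    = refl
C-2-falling (suc j) = begin
  2 * ((3 + j) C 2)                       ≡⟨ cong (2 *_) (suc-C-2 (2 + j)) ⟩
  2 * ((2 + j) + (2 + j) C 2)             ≡⟨ *-distribˡ-+ 2 (2 + j) _ ⟩
  2 * (2 + j) + 2 * ((2 + j) C 2)         ≡⟨ cong (λ c → 2 * (2 + j) + c) (C-2-falling j) ⟩
  2 * (2 + j) + (2 + j) * (1 + j)         ≡⟨ expand j ⟩
  (3 + j) * (2 + j)                       ∎
  where
  open ≡-Reasoning
  expand : ∀ j → 2 * (2 + j) + (2 + j) * (1 + j) ≡ (3 + j) * (2 + j)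
  expand = solve-∀

C-3-falling : ∀ j → 6 * ((3 + j) C 3) ≡ (3 + j) * (2 + j) * (1 + j)
C-3-falling zero    = refl
C-3-falling (suc j) = begin
  6 * ((4 + j) C 3)                                   ≡⟨ cong (6 *_) (nCk+nC[k+1]≡[n+1]C[k+1] (3 + j) 2) ⟨
  6 * ((3 + j) C 2 + (3 + j) C 3)                     ≡⟨ *-distribˡ-+ 6 ((3 + j) C 2) _ ⟩
  6 * ((3 + j) C 2) + 6 * ((3 + j) C 3)               ≡⟨ cong (_+ 6 * ((3 + j) C 3)) (*-assoc 3 2 ((3 + j) C 2)) ⟩
  3 * (2 * ((3 + j) C 2)) + 6 * ((3 + j) C 3)         ≡⟨ cong₂ (λ c d → 3 * c + d) (C-2-falling (suc j)) (C-3-falling j) ⟩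
  3 * ((3 + j) * (2 + j)) + (3 + j) * (2 + j) * (1 + j) ≡⟨ expand j ⟩
  (4 + j) * (3 + j) * (2 + j)                         ∎
  where
  open ≡-Reasoning
  expand : ∀ j → 3 * ((3 + j) * (2 + j)) + (3 + j) * (2 + j) * (1 + j) ≡ (4 + j) * (3 + j) * (2 + j)
  expand = solve-∀

0<C-3 : ∀ j → 0 < (3 + j) C 3
0<C-3 j with (3 + j) C 3 | C-3-falling j
... | suc _ | _ = z<s

falling-≤-cube : ∀ j → (3 + j) * (2 + j) * (1 + j) ≤ (3 + j) * (3 + j) * (3 + j)
falling-≤-cube j = subst ((3 + j) * (2 + j) * (1 + j) ≤_) (expand j) (m≤m+n _ ((3 + j) * (7 + 3 * j)))
  where expand : ∀ j → (3 + j) * (2 + j) * (1 + j) + (3 + j) * (7 + 3 * j) ≡ (3 + j) * (3 + j) * (3 + j)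
        expand = solve-∀

cube-≤-falling : ∀ b j → 3 * (b + 1) ≤ j →
  (b + 1) * ((3 + j) * (3 + j) * (3 + j)) ≤ (b + 2) * ((3 + j) * (2 + j) * (1 + j))
cube-≤-falling b j 3[b+1]≤j with d , refl ← m≤n⇒∃[o]m+o≡n 3[b+1]≤j =
  subst ((b + 1) * (n * n * n) ≤_) (expand b d) (m≤m+n _ (2 * n + n * n * d + 2 * (b + 1) * n))
  where
  n = 3 + (3 * (b + 1) + d)
  expand : ∀ b d → let n = 3 + (3 * (b + 1) + d) in
    (b + 1) * (n * n * n) + (2 * n + n * n * d + 2 * (b + 1) * n)
    ≡ (b + 2) * (n * (2 + (3 * (b + 1) + d)) * (1 + (3 * (b + 1) + d)))
  expand = solve-∀

square-≤-falling : ∀ D j → D ≤ j → D * ((3 + j) * (3 + j)) ≤ (3 + j) * (2 + j) * (1 + j)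
square-≤-falling D j D≤j with d , refl ← m≤n⇒∃[o]m+o≡n D≤j =
  subst (D * (n * n) ≤_) (expand D d) (m≤m+n _ (2 * n + n * n * d))
  where
  n = 3 + (D + d)
  expand : ∀ D d → let n = 3 + (D + d) in
    D * (n * n) + (2 * n + n * n * d) ≡ n * (2 + (D + d)) * (1 + (D + d))
  expand = solve-∀

-- For ε ≥ 1/Q take M = 4Q and t = ⌊√(12M²)⌋: then t/M ≤ √12 < (t+1)/M, and ε > 2/M absorbs
-- the rounding in the estimates of maxν for large n.
module Approximation {Π : List (List ℕ)} (112∈Π : p112 ∈ Π) (Π⊆ : All (_∈ family112) Π) (q′ : ℕ) where

  Q = suc q′
  M = 4 * Q

  root : Σ[ t ∈ ℕ ] t * t ≤ 12 * (M * M) × 12 * (M * M) < suc t * suc t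
  root = isqrt (12 * (M * M))

  t = proj₁ root

  3M≤t : 3 * M ≤ t
  3M≤t = ≮⇒≥ λ t<3M → <-irrefl refl (begin-strict
    12 * (M * M)        <⟨ proj₂ (proj₂ root) ⟩
    suc t * suc t       ≤⟨ *-mono-≤ t<3M t<3M ⟩
    3 * M * (3 * M)     ≡⟨ nine M ⟩
    9 * (M * M)         ≤⟨ *-monoˡ-≤ (M * M) (≤-trans (n≤1+n 9) (≤-trans (n≤1+n 10) (n≤1+n 11))) ⟩
    12 * (M * M)        ∎)
    where open ≤-Reasoning
          nine : ∀ M → 3 * M * (3 * M) ≡ 9 * (M * M)
          nine = solve-∀

  B = t ∸ 3 * M
  D = 2 * (t * t)
  threshold = 3 * (B + 1) + D

  B+3M≡t : B + 3 * M ≡ t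
  B+3M≡t = m∸n+n≡m 3M≤t

  module _ (j : ℕ) (threshold≤j : threshold ≤ j) where

    private
      n = 3 + j
      V = maxν Π n n
      Cn = n C 3
      open ≤-Reasoning

    upper-estimate : M * V + 3 * M * Cn ≤ (t + 2) * Cn
    upper-estimate = begin
      M * V + 3 * M * Cn          ≤⟨ +-monoˡ-≤ (3 * M * Cn) MV≤[B+2]C ⟩
      (B + 2) * Cn + 3 * M * Cn   ≡⟨ collect B M Cn ⟩
      (B + 3 * M + 2) * Cn        ≡⟨ cong (λ s → (s + 2) * Cn) B+3M≡t ⟩
      (t + 2) * Cn                ∎
      where
      collect : ∀ B M C → (B + 2) * C + 3 * M * C ≡ (B + 3 * M + 2) * C
      collect = solve-∀
      B+1+3M≡1+t : B + 1 + 3 * M ≡ suc t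
      B+1+3M≡1+t = trans (+-assoc B 1 (3 * M)) (trans (+-suc B (3 * M)) (cong suc B+3M≡t))
      disc : 12 * (M * M) ≤ (B + 1 + 3 * M) * (B + 1 + 3 * M)
      disc = subst (λ s → 12 * (M * M) ≤ s * s) (sym B+1+3M≡1+t) (<⇒≤ (proj₂ (proj₂ root)))
      MV≤[B+2]C : M * V ≤ (B + 2) * Cn
      MV≤[B+2]C = *-cancelˡ-≤ 6 (begin
        6 * (M * V)                       ≡⟨ *-assoc 6 M V ⟨
        6 * M * V                         ≤⟨ maxν-upper Π⊆ (B + 1) M disc n n ⟩
        (B + 1) * (n * n * n)             ≤⟨ cube-≤-falling B j (≤-trans (m≤m+n (3 * (B + 1)) D) threshold≤j) ⟩
        (B + 2) * ((3 + j) * (2 + j) * (1 + j)) ≡⟨ cong ((B + 2) *_) (C-3-falling j) ⟨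
        (B + 2) * (6 * Cn)                ≡⟨ swap (B + 2) Cn ⟩
        6 * ((B + 2) * Cn)                ∎)
        where swap : ∀ a c → a * (6 * c) ≡ 6 * (a * c)
              swap = solve-∀

    lower-estimate : t * Cn ≤ M * V + Cn + 3 * M * Cn
    lower-estimate = begin
      t * Cn                      ≡⟨ cong (_* Cn) B+3M≡t ⟨
      (B + 3 * M) * Cn            ≡⟨ *-distribʳ-+ Cn B (3 * M) ⟩
      B * Cn + 3 * M * Cn         ≤⟨ +-monoˡ-≤ (3 * M * Cn) BC≤MV+C ⟩
      M * V + Cn + 3 * M * Cn     ∎
      where
      disc : (B + 3 * M) * (B + 3 * M) ≤ 12 * (M * M)
      disc = subst (λ s → s * s ≤ 12 * (M * M)) (sym B+3M≡t) (proj₁ (proj₂ root))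
      BC≤MV+C : B * Cn ≤ M * V + Cn
      BC≤MV+C = *-cancelˡ-≤ 6 (begin
        6 * (B * Cn)                         ≡⟨ swap B Cn ⟩
        B * (6 * Cn)                         ≡⟨ cong (B *_) (C-3-falling j) ⟩
        B * ((3 + j) * (2 + j) * (1 + j))    ≤⟨ *-monoʳ-≤ B (falling-≤-cube j) ⟩
        B * (n * n * n)                      ≤⟨ maxν-lower 112∈Π B M disc n ⟩
        6 * M * V + 2 * ((B + 3 * M) * (B + 3 * M)) * (n * n)
          ≡⟨ cong (λ s → 6 * M * V + 2 * (s * s) * (n * n)) B+3M≡t ⟩
        6 * M * V + D * (n * n)              ≤⟨ +-monoʳ-≤ (6 * M * V) (square-≤-falling D j (≤-trans (m≤n+m D (3 * (B + 1))) threshold≤j)) ⟩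
        6 * M * V + (3 + j) * (2 + j) * (1 + j) ≡⟨ cong (λ c → 6 * M * V + c) (C-3-falling j) ⟨
        6 * M * V + 6 * Cn                   ≡⟨ factor M V Cn ⟩
        6 * (M * V + Cn)                     ∎)
        where swap : ∀ b c → 6 * (b * c) ≡ b * (6 * c)
              swap = solve-∀
              factor : ∀ M V C → 6 * M * V + 6 * C ≡ 6 * (M * V + C)
              factor = solve-∀

  close-at : ∀ k V Cn → t * Cn ≤ M * V + Cn + 3 * M * Cn → M * V + 3 * M * Cn ≤ (t + 2) * Cn → 0 < Cn →
             AboveAlpha (ratio V Cn ℚ.+ ratio (suc k) Q) × BelowAlpha (ratio V Cn ℚ.- ratio (suc k) Q)
  close-at k V (suc c′) lower upper _ =
    aboveAlpha-of-ratio-bound V c′ k q′ (q′ + 3 * Q) t 2Q<KM lower (proj₂ (proj₂ root)) ,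
    belowAlpha-of-ratio-bound V c′ k q′ (q′ + 3 * Q) t 2Q<KM upper (proj₁ (proj₂ root))
    where
    2Q<KM : 2 * Q < suc k * M
    2Q<KM = <-≤-trans (*-monoˡ-< Q {2} {4} (s≤s (s≤s (s≤s z≤n)))) (m≤n*m M (suc k))

  δ-close-to-α : ∀ k n → 3 + threshold ≤ n →
                 AboveAlpha (δ 3 Π n n ℚ.+ ratio (suc k) Q) × BelowAlpha (δ 3 Π n n ℚ.- ratio (suc k) Q)
  δ-close-to-α k n 3+threshold≤n with j , refl ← m≤n⇒∃[o]m+o≡n (≤-trans (m≤m+n 3 threshold) 3+threshold≤n) =
    close-at k (maxν Π (3 + j) (3 + j)) ((3 + j) C 3) (lower-estimate j threshold≤j) (upper-estimate j threshold≤j) (0<C-3 j)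
    where
    threshold≤j : threshold ≤ j
    threshold≤j = +-cancelˡ-≤ 3 threshold j 3+threshold≤n

density-of-112-family : ∀ {Π} → p112 ∈ Π → All (_∈ family112) Π → DensityIsAlpha 3 Π
density-of-112-family {Π} 112∈Π Π⊆ = (λ n → δ 3 Π n n) , δ-stabilises , δ-converges
  where
  δ-stabilises : ∀ n → ConvergesTo (λ k → δ 3 Π k n) (δ 3 Π n n)
  δ-stabilises n ε 0<ε = n , λ k n≤k →
    subst (λ v → ℚ.∣ ratio v (n C 3) ℚ.- δ 3 Π n n ∣ ℚ.< ε) (sym (maxν-stable Π n≤k))
          (subst (λ z → ℚ.∣ z ∣ ℚ.< ε) (sym (ℚ.+-inverseʳ (δ 3 Π n n))) 0<ε)
  δ-converges : ConvergesToAlpha (λ n → δ 3 Π n n)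
  δ-converges (mkℚ (ℤ.+ 0)     _  _) (ℚ.*<* (ℤ.+<+ ()))
  δ-converges (mkℚ ℤ.-[1+ _ ]  _  _) (ℚ.*<* ())
  δ-converges (mkℚ ℤ.+[1+ k ]  q′ coprime) _ =
    subst (λ ε → Σ[ N ∈ ℕ ] (∀ n → N ≤ n → AboveAlpha (δ 3 Π n n ℚ.+ ε) × BelowAlpha (δ 3 Π n n ℚ.- ε)))
          (ℚ.normalize-coprime coprime)
          (3 + threshold , δ-close-to-α k)
    where open Approximation 112∈Π Π⊆ q′

proposition3p2 : DensityIsAlpha 3 (p112 ∷ [])
                 × DensityIsAlpha 3 (p112 ∷ p121 ∷ [])
                 × DensityIsAlpha 3 (p112 ∷ p121 ∷ p211 ∷ [])
proposition3p2 =
  density-of-112-family (here refl) (here refl ∷ []) ,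
  density-of-112-family (here refl) (here refl ∷ there (here refl) ∷ []) ,
  density-of-112-family (here refl) (here refl ∷ there (here refl) ∷ there (there (here refl)) ∷ [])
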